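{- For all $n,k\ge0$, $$\mathtt B_{n,k}\big(\Psi_{\{\{1\}\}}(\mathbb A),\Psi_{\{\{1,2\}\}}(\mathbb A),\dots,\Psi_{\{\{1,\dots,m\}\}}(\mathbb A),\dots\big)=\mathcal B_{n,k}\big(\Psi_{\{\{1\}\}}(\mathbb A),\Psi_{\{\{1,2\}\}}(\mathbb A),\dots,\Psi_{\{\{1,\dots,m\}\}}(\mathbb A),\dots\big)$$ and $$\mathtt B_{n,k}\big(\Phi_{\{\{1\}\}}(\mathbb A),\Phi_{\{\{1,2\}\}}(\mathbb A),\dots,\Phi_{\{\{1,\dots,m\}\}}(\mathbb A),\dots\big)=\mathfrak B_{n,k}(\mathbb A).$$
   Context: $\mathbb A$ is an infinite alphabet of noncommuting variables, $\mathbb C\langle\mathbb A\rangle$ the free associative algebra, $\mathbin{\sqcup\!\sqcup}$ the shuffle product of words (extended bilinearly), and powers $F^{\mathbin{\sqcup\!\sqcup} k}$ are taken for the shuffle product. For a set partition $\pi=\{\pi_1,\dots,\pi_k\}$ of $\{1,\dots,n\}$: $\Phi_\pi(\mathbb A)=\sum\mathtt w$ over words $\mathtt w=\mathtt a_1\cdots\mathtt a_n$ over $\mathbb A$ such that $i,j$ in a common block implies $\mathtt a_i=\mathtt a_j$; and $\Psi_\pi(\mathbb A)=\#\pi_1!\cdots\#\pi_k!\,\Phi_\pi(\mathbb A)$. For a sequence $(F_i)_{i\ge1}$ of elements of $\mathbb C\langle\mathbb A\rangle$, $\mathtt B_{n,k}(F_1,F_2,\dots)$ is defined by $\sum_{n\ge0}\mathtt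 B_{n,k}(F_1,F_2,\dots)t^n=\frac1{k!}\big(\sum_{i\ge1}F_it^i\big)^{\mathbin{\sqcup\!\sqcup} k}$. For elements $F_1,F_2,\dots$ of the commutative algebra $(\mathbf{WSym}(\mathbb A),\mathbin{\sqcup\!\sqcup})$ (the span of the $\Phi_\pi(\mathbb A)$), $\mathcal B_{n,k}(F_1,F_2,\dots)=\frac1{n!}B_{n,k}(1!F_1,2!F_2,\dots,m!F_m,\dots)$ evaluated with the shuffle product, where $B_{n,k}$ is the partial Bell polynomial: $\sum_{n}B_{n,k}(x_1,x_2,\dots)\frac{t^n}{n!}=\frac1{k!}\big(\sum_{i\ge1}x_i\frac{t^i}{i!}\big)^k$. Finally, $\mathfrak B_{n,k}(\mathbb A)=\sum_\pi\Phi_\pi(\mathbb A)$, summed over set partitions $\pi$ of $\{1,\dots,n\}$ with exactly $k$ blocks (this is the image in the realization $\mathbf{WSym}(\mathbb A)$ of the element $\mathfrak B_{n,k}$ of word symmetric functions, the coefficient of $t^k$ in $T^n(1)$ with $T(x)=t\,x\,\Phi_{\{\{1\}\}}+\partial(x)$, where $\partial(\Phi_{\{\pi_1,\dots,\pi_k\}})=\sum_i\Phi_{(\pi\setminus\{\pi_i\})\cup\{\pi_i\cup\{n+1\}\}}$). -}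

module Defs where

open import Data.Bool using (Bool; true; false; _∧_; _∨_; not; if_then_else_)
open import Data.Nat as ℕ using (ℕ; zero; suc; _∸_; _≡ᵇ_; _!)
open import Data.Nat.Properties using (_!≢0)
open import Data.Fin using (Fin; toℕ)
open import Data.Vec as Vec using (Vec; []; _∷_)
open import Data.List as List using (List; []; _∷_; length; allFin; filter; map; concatMap)
open import Data.Integer using (+_)
open import Data.Rational using (ℚ; 0ℚ; 1ℚ; _+_; _*_; _/_)
open import Relation.Nullary.Decidable using (does)
open import Relation.Binary.PropositionalEquality using (_≡_)

-- Alphabet 𝔸 = ℕ (infinite). Words = List ℕ.
-- Since Φ_π(𝔸) is an infinite sum of words, elements are formal series:
-- a series is its coefficient function on words (coefficients in ℚ).

Word : Set
Word = List ℕ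

Series : Set
Series = Word → ℚ

zeroS : Series
zeroS _ = 0ℚ

oneS : Series
oneS []      = 1ℚ
oneS (_ ∷ _) = 0ℚ

_⊕_ : Series → Series → Series
(F ⊕ G) w = F w + G w

scale : ℚ → Series → Series
scale c F w = c * F w

inv! : ℕ → ℚ
inv! m = (+ 1) / (m !) where instance _ = m !≢0

fact : ℕ → ℚ
fact m = (+ (m !)) / 1

-- Shuffle product extended bilinearly to series. Coefficient-wise it is
-- the dual of  au ⧢ bv = a(u ⧢ bv) + b(au ⧢ v),  ε ⧢ v = v ⧢ ε = v :
--   ⟨F ⧢ G, ε⟩ = ⟨F,ε⟩⟨G,ε⟩,
--   ⟨F ⧢ G, a w⟩ = ⟨a⁻¹F ⧢ G, w⟩ + ⟨F ⧢ a⁻¹G, w⟩.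
_⧢_ : Series → Series → Series
(F ⧢ G) []      = F [] * G []
(F ⧢ G) (a ∷ w) = ((λ u → F (a ∷ u)) ⧢ G) w + (F ⧢ (λ u → G (a ∷ u))) w

-- Formal power series in t with coefficients in series: coefficient of t^n.

TSeries : Set
TSeries = ℕ → Series

sumUpTo : ℕ → (ℕ → Series) → Series
sumUpTo zero    h = h zero
sumUpTo (suc n) h = sumUpTo n h ⊕ h (suc n)

tmul : TSeries → TSeries → TSeries
tmul f g n = sumUpTo n (λ i → f i ⧢ g (n ∸ i))

tpow : TSeries → ℕ → TSeries
tpow f zero    zero    = oneS
tpow f zero    (suc _) = zeroS
tpow f (suc k) n       = tmul f (tpow f k) n

-- Σ_{i≥1} F_i t^i  (the sequence is indexed from 1; F 0 is ignored)
genFun : (ℕ → Series) → TSeries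
genFun F zero    = zeroS
genFun F (suc i) = F (suc i)

Bword : ℕ → ℕ → (ℕ → Series) → Series
Bword n k F = scale (inv! k) (tpow (genFun F) k n)

-- Partial (exponential) Bell polynomial B_{n,k}(x_1,x_2,…) evaluated in the
-- commutative ℚ-algebra (series, ⧢), via its defining generating function
--   Σ_n B_{n,k}(x) t^n/n! = (1/k!)(Σ_i x_i t^i/i!)^k.
BellPartial : ℕ → ℕ → (ℕ → Series) → Series
BellPartial n k x =
  scale (fact n) (scale (inv! k) (tpow (λ i → scale (inv! i) (genFun x i)) k n))

Bcal : ℕ → ℕ → (ℕ → Series) → Series
Bcal n k F = scale (inv! n) (BellPartial n k (λ m → scale (fact m) (F m)))

-- A block is a subset
-- (Vec Bool n); a set partition is a finite SET of blocks, represented as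
-- a list of blocks strictly increasing for the lexicographic order
-- (so that each set of blocks has exactly one representation).

Block : ℕ → Set
Block n = Vec Bool n

member : ∀ {n} → Block n → Fin n → Bool
member b i = Vec.lookup b i

blockSize : ∀ {n} → Block n → ℕ
blockSize []          = zero
blockSize (true ∷ b)  = suc (blockSize b)
blockSize (false ∷ b) = blockSize b

nonempty : ∀ {n} → Block n → Bool
nonempty []      = false
nonempty (x ∷ b) = x ∨ nonempty b

lexLt : ∀ {n} → Block n → Block n → Bool
lexLt []          []          = false
lexLt (false ∷ b) (true ∷ c)  = true
lexLt (true ∷ b)  (false ∷ c) = false
lexLt (x ∷ b)     (y ∷ c)     = lexLt b c

sortedStrict : ∀ {n} → List (Block n) → Bool
sortedStrict []           = true
sortedStrict (b ∷ [])     = true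
sortedStrict (b ∷ c ∷ bs) = lexLt b c ∧ sortedStrict (c ∷ bs)

allB : {A : Set} → (A → Bool) → List A → Bool
allB p xs = List.foldr (λ x r → p x ∧ r) true xs

countB : {A : Set} → (A → Bool) → List A → ℕ
countB p xs = length (filter (λ x → Data.Bool._≟_ (p x) true) xs)
  where import Data.Bool

isSetPartition : (n : ℕ) → List (Block n) → Bool
isSetPartition n bs =
  allB nonempty bs
  ∧ allB (λ i → countB (λ b → member b i) bs ≡ᵇ 1) (allFin n)
  ∧ sortedStrict bs

allBlocks : (n : ℕ) → List (Block n)
allBlocks zero    = Vec.[] ∷ []
allBlocks (suc n) = concatMap (λ b → (false ∷ b) ∷ (true ∷ b) ∷ []) (allBlocks n)

listsOfLength : {A : Set} → ℕ → List A → List (List A)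
listsOfLength zero    xs = [] ∷ []
listsOfLength (suc k) xs = concatMap (λ x → map (x ∷_) (listsOfLength k xs)) xs

setPartitions : (n k : ℕ) → List (List (Block n))
setPartitions n k = filter (λ bs → Data.Bool._≟_ (isSetPartition n bs) true)
                           (listsOfLength k (allBlocks n))
  where import Data.Bool

nth : Word → ℕ → ℕ
nth []      _       = zero
nth (a ∷ w) zero    = a
nth (a ∷ w) (suc i) = nth w i

constantOn : ∀ {n} → Word → Block n → Bool
constantOn {n} w b =
  allB (λ i → allB (λ j → not (member b i ∧ member b j) ∨ (nth w (toℕ i) ≡ᵇ nth w (toℕ j)))
                   (allFin n))
       (allFin n)

Phi : (n : ℕ) → List (Block n) → Series
Phi n π w = if (length w ≡ᵇ n) ∧ allB (constantOn w) π then 1ℚ else 0ℚ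

Psi : (n : ℕ) → List (Block n) → Series
Psi n π = scale (List.foldr (λ b r → fact (blockSize b) * r) 1ℚ π) (Phi n π)

fullPartition : (m : ℕ) → List (Block m)
fullPartition m = Vec.replicate m true ∷ []

PhiSeq : ℕ → Series
PhiSeq m = Phi m (fullPartition m)

PsiSeq : ℕ → Series
PsiSeq m = Psi m (fullPartition m)

Bfrak : ℕ → ℕ → Series
Bfrak n k w = List.foldr (λ π r → Phi n π w + r) 0ℚ (setPartitions n k)

_≐_ : Series → Series → Set
F ≐ G = ∀ w → F w ≡ G w

-- The first identity is a rescaling: the factors i! inserted by 𝓑 are cancelled
-- by the 1/i! of the exponential Bell polynomial, and 1/n! by its n!.
-- For the second, expanding the shuffle coefficientwise shows that the coefficient
-- of a word w in the k-th shuffle power of Σ_{i ≥ 1} Φ_{{1,…,i}} tⁱ counts the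
-- ordered k-tuples of pairwise disjoint nonempty sets of positions covering w, on
-- each of which w is constant.  Each set partition of the positions into k blocks
-- on which w is constant arises from exactly k! such tuples (its orderings), so
-- the factor 1/k! leaves the coefficient of w in 𝔅_{n,k}.

module Submission where

open import Defs
open import Algebra.Bundles using (CommutativeMonoid)
import Algebra.Properties.CommutativeSemigroup as CommSemigroupProps
open import Data.Bool as Bool using (Bool; true; false; _∧_; _∨_; not; if_then_else_)
open import Data.Bool.Properties as BoolP using (∧-conicalˡ; ∧-conicalʳ; ¬-not; ⇔→≡)
open import Data.Empty using (⊥-elim)
open import Data.Fin as Fin using (Fin; toℕ)
open import Data.Integer as ℤ using ()
import Data.Integer.Properties as ℤP
import Data.List.Properties as ListP
open import Data.List as List using (List; []; _∷_; _++_; map; concatMap; length; allFin; filter; tabulate)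
open import Data.Maybe using (nothing)
open import Data.Nat as ℕ using (ℕ; zero; suc; _∸_; _≡ᵇ_; _!; _≤_; _<_; z≤n; NonZero)
import Data.Nat.Properties as ℕP
open import Data.Nat.Properties using (_!≢0)
import Data.Nat.Coprimality as Coprime
open import Data.Product using (Σ; _×_; _,_)
open import Data.Rational using (ℚ; 0ℚ; 1ℚ; _+_; _*_; _/_; mkℚ)
open import Data.Rational.Properties
import Data.Rational.Unnormalised as ℚᵘ
import Data.Rational.Unnormalised.Properties as ℚᵘP
open import Data.Sum using (_⊎_; inj₁; inj₂)
open import Data.Vec as Vec using (Vec; []; _∷_)
import Data.Vec.Properties as VecP
open import Function using (_∘_; mk⇔; Equivalence)
open import Relation.Binary.Definitions using (DecidableEquality)
open import Relation.Binary.PropositionalEquality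
open import Relation.Nullary using (Dec; yes; no; does)
open import Relation.Nullary.Decidable using (dec-true; dec-false)
open import Tactic.RingSolver using (solve-∀)
open import Tactic.RingSolver.Core.AlmostCommutativeRing using (AlmostCommutativeRing; fromCommutativeRing)

private variable
  A B : Set

ℚ-ring : AlmostCommutativeRing _ _
ℚ-ring = fromCommutativeRing +-*-commutativeRing (λ _ → nothing)

true≢false : true ≢ false
true≢false ()

does-true⇒ : ∀ {P : Set} (P? : Dec P) → does P? ≡ true → P
does-true⇒ (yes p) _  = p
does-true⇒ (no _)  ()

𝟙 : Bool → ℚ
𝟙 true  = 1ℚ
𝟙 false = 0ℚ

𝟙-∧ : ∀ a b → 𝟙 (a ∧ b) ≡ 𝟙 a * 𝟙 b
𝟙-∧ true  b = sym (*-identityˡ (𝟙 b))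
𝟙-∧ false b = sym (*-zeroˡ (𝟙 b))

if-𝟙 : ∀ b → (if b then 1ℚ else 0ℚ) ≡ 𝟙 b
if-𝟙 true  = refl
if-𝟙 false = refl

𝟙-guard : ∀ c {p q : ℚ} → (c ≡ true → p ≡ q) → 𝟙 c * p ≡ 𝟙 c * q
𝟙-guard true          p≡q = cong (1ℚ *_) (p≡q refl)
𝟙-guard false {p} {q} _   = trans (*-zeroˡ p) (sym (*-zeroˡ q))

𝟙ℕ : Bool → ℕ
𝟙ℕ true  = 1
𝟙ℕ false = 0

module ℕ+ = CommSemigroupProps ℕP.+-commutativeSemigroup

module ℚ+ = CommSemigroupProps (CommutativeMonoid.commutativeSemigroup +-0-commutativeMonoid)
module ℚ* = CommSemigroupProps (CommutativeMonoid.commutativeSemigroup *-1-commutativeMonoid)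

∑ : List A → (A → ℚ) → ℚ
∑ []       f = 0ℚ
∑ (x ∷ xs) f = f x + ∑ xs f

syntax ∑ xs (λ x → e) = ∑[ x ∈ xs ] e

∑-cong : (xs : List A) {f g : A → ℚ} → (∀ x → f x ≡ g x) → ∑ xs f ≡ ∑ xs g
∑-cong []       f≗g = refl
∑-cong (x ∷ xs) f≗g = cong₂ _+_ (f≗g x) (∑-cong xs f≗g)

∑-++ : (xs ys : List A) (f : A → ℚ) → ∑ (xs ++ ys) f ≡ ∑ xs f + ∑ ys f
∑-++ []       ys f = sym (+-identityˡ _)
∑-++ (x ∷ xs) ys f = trans (cong (f x +_) (∑-++ xs ys f)) (sym (+-assoc (f x) _ _))

∑-+ : (xs : List A) (f g : A → ℚ) → ∑[ x ∈ xs ] (f x + g x) ≡ ∑ xs f + ∑ xs g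
∑-+ []       f g = sym (+-identityˡ _)
∑-+ (x ∷ xs) f g = trans (cong ((f x + g x) +_) (∑-+ xs f g)) (ℚ+.interchange (f x) (g x) _ _)

*-distribˡ-∑ : (c : ℚ) (xs : List A) (f : A → ℚ) → c * ∑ xs f ≡ ∑[ x ∈ xs ] (c * f x)
*-distribˡ-∑ c []       f = *-zeroʳ c
*-distribˡ-∑ c (x ∷ xs) f = trans (*-distribˡ-+ c (f x) _) (cong (c * f x +_) (*-distribˡ-∑ c xs f))

∑-zero : (xs : List A) → ∑[ x ∈ xs ] 0ℚ ≡ 0ℚ
∑-zero []       = refl
∑-zero (x ∷ xs) = trans (+-identityˡ _) (∑-zero xs)

∑-comm : (xs : List A) (ys : List B) (f : A → B → ℚ) →
         ∑[ x ∈ xs ] ∑[ y ∈ ys ] f x y ≡ ∑[ y ∈ ys ] ∑[ x ∈ xs ] f x y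
∑-comm []       ys f = sym (∑-zero ys)
∑-comm (x ∷ xs) ys f = trans (cong (∑ ys (f x) +_) (∑-comm xs ys f))
                             (sym (∑-+ ys (f x) (λ y → ∑[ x′ ∈ xs ] f x′ y)))

∑-map : (g : A → B) (xs : List A) (f : B → ℚ) → ∑ (map g xs) f ≡ ∑[ x ∈ xs ] f (g x)
∑-map g []       f = refl
∑-map g (x ∷ xs) f = cong (f (g x) +_) (∑-map g xs f)

∑-concatMap : (g : A → List B) (xs : List A) (f : B → ℚ) →
              ∑ (concatMap g xs) f ≡ ∑[ x ∈ xs ] ∑ (g x) f
∑-concatMap g []       f = refl
∑-concatMap g (x ∷ xs) f =
  trans (∑-++ (g x) (concatMap g xs) f) (cong (∑ (g x) f +_) (∑-concatMap g xs f))

∑≤ : ℕ → (ℕ → ℚ) → ℚ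
∑≤ zero    h = h zero
∑≤ (suc n) h = ∑≤ n h + h (suc n)

syntax ∑≤ n (λ i → e) = ∑[ i ≤ n ] e

∑≤-cong : ∀ n {f g : ℕ → ℚ} → (∀ i → f i ≡ g i) → ∑≤ n f ≡ ∑≤ n g
∑≤-cong zero    f≗g = f≗g zero
∑≤-cong (suc n) f≗g = cong₂ _+_ (∑≤-cong n f≗g) (f≗g (suc n))

∑≤-∑-comm : (n : ℕ) (xs : List A) (f : ℕ → A → ℚ) →
            ∑[ i ≤ n ] ∑ xs (f i) ≡ ∑[ x ∈ xs ] ∑[ i ≤ n ] f i x
∑≤-∑-comm zero    xs f = refl
∑≤-∑-comm (suc n) xs f = trans (cong (_+ ∑ xs (f (suc n))) (∑≤-∑-comm n xs f))
                               (sym (∑-+ xs (λ x → ∑[ i ≤ n ] f i x) (f (suc n))))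

*-distribˡ-∑≤ : ∀ c n (f : ℕ → ℚ) → c * ∑≤ n f ≡ ∑[ i ≤ n ] (c * f i)
*-distribˡ-∑≤ c zero    f = refl
*-distribˡ-∑≤ c (suc n) f = trans (*-distribˡ-+ c _ _) (cong (_+ c * f (suc n)) (*-distribˡ-∑≤ c n f))

sumUpTo-apply : ∀ n (h : ℕ → Series) w → sumUpTo n h w ≡ ∑[ i ≤ n ] h i w
sumUpTo-apply zero    h w = refl
sumUpTo-apply (suc n) h w = cong (_+ h (suc n) w) (sumUpTo-apply n h w)

≡⇒≡ᵇ-true : ∀ {m n} → m ≡ n → (m ≡ᵇ n) ≡ true
≡⇒≡ᵇ-true {m} refl = Equivalence.to BoolP.T-≡ (ℕP.≡⇒≡ᵇ m m refl)

≢⇒≡ᵇ-false : ∀ {m n} → m ≢ n → (m ≡ᵇ n) ≡ false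
≢⇒≡ᵇ-false {m} {n} m≢n = ¬-not (λ e → m≢n (ℕP.≡ᵇ⇒≡ m n (Equivalence.from BoolP.T-≡ e)))

≡ᵇ-true⇒≡ : ∀ m n → (m ≡ᵇ n) ≡ true → m ≡ n
≡ᵇ-true⇒≡ m n e = ℕP.≡ᵇ⇒≡ m n (Equivalence.from BoolP.T-≡ e)

δ-≢ : ∀ {c i} (x : ℚ) → c ≢ i → 𝟙 (c ≡ᵇ i) * x ≡ 0ℚ
δ-≢ x c≢i = trans (cong (λ b → 𝟙 b * x) (≢⇒≡ᵇ-false c≢i)) (*-zeroˡ x)

∑≤-δ-absent : ∀ N c (g : ℕ → ℚ) → N < c → ∑[ i ≤ N ] (𝟙 (c ≡ᵇ i) * g i) ≡ 0ℚ
∑≤-δ-absent zero    c g N<c = δ-≢ (g 0) (λ e → ℕP.<-irrefl (sym e) N<c)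
∑≤-δ-absent (suc N) c g N<c = trans
  (cong₂ _+_ (∑≤-δ-absent N c g (ℕP.<-trans (ℕP.n<1+n N) N<c))
             (δ-≢ (g (suc N)) (λ e → ℕP.<-irrefl (sym e) N<c)))
  (+-identityʳ 0ℚ)

∑≤-δ : ∀ N c (g : ℕ → ℚ) → c ≤ N → ∑[ i ≤ N ] (𝟙 (c ≡ᵇ i) * g i) ≡ g c
∑≤-δ zero .zero g z≤n = *-identityˡ (g 0)
∑≤-δ (suc N) c g c≤N with ℕP.m≤n⇒m<n∨m≡n c≤N
... | inj₁ c<1+N = trans (cong₂ _+_ (∑≤-δ N c g (ℕP.≤-pred c<1+N))
                                    (δ-≢ (g (suc N)) (λ e → ℕP.<-irrefl e c<1+N)))
                         (+-identityʳ (g c))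
... | inj₂ refl  = trans (cong₂ _+_ (∑≤-δ-absent N (suc N) g (ℕP.n<1+n N))
                                    (cong (λ b → 𝟙 b * g (suc N)) (≡⇒≡ᵇ-true {suc N} refl)))
                         (trans (+-identityˡ _) (*-identityˡ (g (suc N))))

∑≤-δ-convolution : ∀ N c d → ∑[ i ≤ N ] (𝟙 (c ≡ᵇ i) * 𝟙 (d ≡ᵇ N ∸ i)) ≡ 𝟙 (c ℕ.+ d ≡ᵇ N)
∑≤-δ-convolution N c d with c ℕ.≤? N
... | yes c≤N = trans (∑≤-δ N c (λ i → 𝟙 (d ≡ᵇ N ∸ i)) c≤N) (cong 𝟙 (⇔→≡ (mk⇔
        (λ e → ≡⇒≡ᵇ-true (trans (cong (c ℕ.+_) (≡ᵇ-true⇒≡ d (N ∸ c) e)) (ℕP.m+[n∸m]≡n c≤N)))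
        (λ e → ≡⇒≡ᵇ-true (trans (sym (ℕP.m+n∸m≡n c d)) (cong (_∸ c) (≡ᵇ-true⇒≡ (c ℕ.+ d) N e)))))))
... | no c≰N  = trans (∑≤-δ-absent N c (λ i → 𝟙 (d ≡ᵇ N ∸ i)) (ℕP.≰⇒> c≰N))
        (cong 𝟙 (sym (≢⇒≡ᵇ-false (λ e → c≰N (subst (c ≤_) e (ℕP.m≤m+n c d))))))

fromℕ : ℕ → ℚ
fromℕ n = (ℤ.+ n) / 1

private
  fromℕ′ : ℕ → ℚ
  fromℕ′ n = mkℚ (ℤ.+ n) 0 (Coprime.sym (Coprime.1-coprimeTo n))

  fromℕ≡fromℕ′ : ∀ n → fromℕ n ≡ fromℕ′ n
  fromℕ≡fromℕ′ n = normalize-coprime (Coprime.sym (Coprime.1-coprimeTo n))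

fromℕ-+ : ∀ m n → fromℕ (m ℕ.+ n) ≡ fromℕ m + fromℕ n
fromℕ-+ m n = begin
    fromℕ (m ℕ.+ n)            ≡⟨ fromℕ≡fromℕ′ (m ℕ.+ n) ⟩
    fromℕ′ (m ℕ.+ n)
      ≡⟨ toℚᵘ-injective (ℚᵘP.≃-trans homo (ℚᵘP.≃-sym (toℚᵘ-homo-+ (fromℕ′ m) (fromℕ′ n)))) ⟩
    fromℕ′ m + fromℕ′ n        ≡⟨ sym (cong₂ _+_ (fromℕ≡fromℕ′ m) (fromℕ≡fromℕ′ n)) ⟩
    fromℕ m + fromℕ n ∎
  where
  open ≡-Reasoning
  homo : ℚᵘ.mkℚᵘ (ℤ.+ (m ℕ.+ n)) 0 ℚᵘ.≃ (ℚᵘ.mkℚᵘ (ℤ.+ m) 0 ℚᵘ.+ ℚᵘ.mkℚᵘ (ℤ.+ n) 0)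
  homo = ℚᵘ.*≡* (cong (ℤ._* ℤ.+ 1) (trans (ℤP.pos-+ m n)
           (cong₂ ℤ._+_ (sym (ℤP.*-identityʳ (ℤ.+ m))) (sym (ℤP.*-identityʳ (ℤ.+ n))))))

fromℕ-* : ∀ m n → fromℕ (m ℕ.* n) ≡ fromℕ m * fromℕ n
fromℕ-* m n = begin
    fromℕ (m ℕ.* n)            ≡⟨ fromℕ≡fromℕ′ (m ℕ.* n) ⟩
    fromℕ′ (m ℕ.* n)
      ≡⟨ toℚᵘ-injective (ℚᵘP.≃-trans homo (ℚᵘP.≃-sym (toℚᵘ-homo-* (fromℕ′ m) (fromℕ′ n)))) ⟩
    fromℕ′ m * fromℕ′ n        ≡⟨ sym (cong₂ _*_ (fromℕ≡fromℕ′ m) (fromℕ≡fromℕ′ n)) ⟩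
    fromℕ m * fromℕ n ∎
  where
  open ≡-Reasoning
  homo : ℚᵘ.mkℚᵘ (ℤ.+ (m ℕ.* n)) 0 ℚᵘ.≃ (ℚᵘ.mkℚᵘ (ℤ.+ m) 0 ℚᵘ.* ℚᵘ.mkℚᵘ (ℤ.+ n) 0)
  homo = ℚᵘ.*≡* (cong (ℤ._* ℤ.+ 1) (ℤP.pos-* m n))

inv!*fact : ∀ m → inv! m * fact m ≡ 1ℚ
inv!*fact m = inverse (m !) {{m !≢0}}
  where
  inverse : ∀ d .{{_ : NonZero d}} → (ℤ.+ 1) / d * fromℕ d ≡ 1ℚ
  inverse (suc d) = trans (cong₂ _*_ (normalize-coprime (Coprime.1-coprimeTo (suc d))) (fromℕ≡fromℕ′ (suc d)))
                          (*-inverseˡ (fromℕ′ (suc d)))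

-- The first identity

⧢-cong : ∀ {F F′ G G′} → F ≐ F′ → G ≐ G′ → (F ⧢ G) ≐ (F′ ⧢ G′)
⧢-cong F≐F′ G≐G′ []      = cong₂ _*_ (F≐F′ []) (G≐G′ [])
⧢-cong F≐F′ G≐G′ (a ∷ w) = cong₂ _+_ (⧢-cong (λ u → F≐F′ (a ∷ u)) G≐G′ w)
                                    (⧢-cong F≐F′ (λ u → G≐G′ (a ∷ u)) w)

sumUpTo-cong : ∀ n {h h′ : ℕ → Series} → (∀ i → h i ≐ h′ i) → sumUpTo n h ≐ sumUpTo n h′
sumUpTo-cong zero    h≐h′ w = h≐h′ zero w
sumUpTo-cong (suc n) h≐h′ w = cong₂ _+_ (sumUpTo-cong n h≐h′ w) (h≐h′ (suc n) w)

tpow-cong : ∀ {f g : TSeries} → (∀ i → f i ≐ g i) → ∀ k n → tpow f k n ≐ tpow g k n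
tpow-cong f≐g zero    zero    w = refl
tpow-cong f≐g zero    (suc n) w = refl
tpow-cong f≐g (suc k) n         = sumUpTo-cong n (λ i → ⧢-cong (f≐g i) (tpow-cong f≐g k (n ∸ i)))

Bword≐Bcal : ∀ n k F → Bword n k F ≐ Bcal n k F
Bword≐Bcal n k F w = sym (begin
    inv! n * (fact n * (inv! k * tpow rescaled k n w))  ≡⟨ *-assoc (inv! n) (fact n) _ ⟨
    (inv! n * fact n) * (inv! k * tpow rescaled k n w)  ≡⟨ cong (_* (inv! k * tpow rescaled k n w)) (inv!*fact n) ⟩
    1ℚ * (inv! k * tpow rescaled k n w)                 ≡⟨ *-identityˡ _ ⟩
    inv! k * tpow rescaled k n w                        ≡⟨ cong (inv! k *_) (tpow-cong rescaled≐ k n w) ⟩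
    inv! k * tpow (genFun F) k n w                      ∎)
  where
  open ≡-Reasoning
  rescaled : TSeries
  rescaled i = scale (inv! i) (genFun (λ m → scale (fact m) (F m)) i)
  rescaled≐ : ∀ i → rescaled i ≐ genFun F i
  rescaled≐ zero    u = *-zeroʳ (inv! 0)
  rescaled≐ (suc i) u = begin
    inv! (suc i) * (fact (suc i) * F (suc i) u)  ≡⟨ *-assoc (inv! (suc i)) _ _ ⟨
    inv! (suc i) * fact (suc i) * F (suc i) u    ≡⟨ cong (_* F (suc i) u) (inv!*fact (suc i)) ⟩
    1ℚ * F (suc i) u                             ≡⟨ *-identityˡ _ ⟩
    F (suc i) u                                  ∎

-- Shuffles of subwords

_↾_ : (w : Word) → Vec Bool (length w) → Word
[]      ↾ []          = []
(a ∷ w) ↾ (true ∷ b)  = a ∷ (w ↾ b)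
(a ∷ w) ↾ (false ∷ b) = w ↾ b

_⊆ᵇ_ : ∀ {n} → Vec Bool n → Vec Bool n → Bool
[]          ⊆ᵇ []      = true
(true ∷ b)  ⊆ᵇ (y ∷ m) = y ∧ (b ⊆ᵇ m)
(false ∷ b) ⊆ᵇ (y ∷ m) = b ⊆ᵇ m

_∖_ : ∀ {n} → Vec Bool n → Vec Bool n → Vec Bool n
[]      ∖ []      = []
(y ∷ m) ∖ (x ∷ b) = (y ∧ not x) ∷ (m ∖ b)

∑-allBlocks-suc : ∀ n (h : Block (suc n) → ℚ) →
  ∑ (allBlocks (suc n)) h ≡ ∑[ b ∈ allBlocks n ] (h (false ∷ b) + h (true ∷ b))
∑-allBlocks-suc n h = trans (∑-concatMap (λ b → (false ∷ b) ∷ (true ∷ b) ∷ []) (allBlocks n) h)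
  (∑-cong (allBlocks n) (λ b → cong (h (false ∷ b) +_) (+-identityʳ (h (true ∷ b)))))

-- Stated for subwords w ↾ m rather than for w, so that the coefficient recursion
-- of ⧢ can be followed by induction on w.
⧢-↾ : ∀ (w : Word) (F G : Series) (m : Vec Bool (length w)) →
  (F ⧢ G) (w ↾ m) ≡ ∑[ b ∈ allBlocks (length w) ] (𝟙 (b ⊆ᵇ m) * (F (w ↾ b) * G (w ↾ (m ∖ b))))
⧢-↾ [] F G [] = sym (trans (+-identityʳ _) (*-identityˡ _))
⧢-↾ (a ∷ w) F G (false ∷ m) = begin
    (F ⧢ G) (w ↾ m)                          ≡⟨ ⧢-↾ w F G m ⟩
    ∑[ b ∈ Bs ] restricted b                 ≡⟨ ∑-cong Bs (λ b → sym (trans (cong (restricted b +_) (*-zeroˡ (usesA b)))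
                                                                            (+-identityʳ (restricted b)))) ⟩
    ∑[ b ∈ Bs ] (restricted b + 0ℚ * usesA b)
                                             ≡⟨ ∑-allBlocks-suc (length w) _ ⟨
    ∑[ b ∈ allBlocks (suc (length w)) ]
      (𝟙 (b ⊆ᵇ (false ∷ m)) * (F ((a ∷ w) ↾ b) * G ((a ∷ w) ↾ ((false ∷ m) ∖ b))))  ∎
  where
  open ≡-Reasoning
  Bs = allBlocks (length w)
  restricted usesA : Block (length w) → ℚ
  restricted b = 𝟙 (b ⊆ᵇ m) * (F (w ↾ b) * G (w ↾ (m ∖ b)))
  usesA b = F (a ∷ (w ↾ b)) * G (w ↾ (m ∖ b))
⧢-↾ (a ∷ w) F G (true ∷ m) = begin
    ((λ u → F (a ∷ u)) ⧢ G) (w ↾ m) + (F ⧢ (λ u → G (a ∷ u))) (w ↾ m)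
      ≡⟨ cong₂ _+_ (⧢-↾ w (λ u → F (a ∷ u)) G m) (⧢-↾ w F (λ u → G (a ∷ u)) m) ⟩
    ∑ Bs aInF + ∑ Bs aInG             ≡⟨ +-comm (∑ Bs aInF) (∑ Bs aInG) ⟩
    ∑ Bs aInG + ∑ Bs aInF             ≡⟨ ∑-+ Bs aInG aInF ⟨
    ∑[ b ∈ Bs ] (aInG b + aInF b)     ≡⟨ ∑-allBlocks-suc (length w) _ ⟨
    ∑[ b ∈ allBlocks (suc (length w)) ]
      (𝟙 (b ⊆ᵇ (true ∷ m)) * (F ((a ∷ w) ↾ b) * G ((a ∷ w) ↾ ((true ∷ m) ∖ b))))  ∎
  where
  open ≡-Reasoning
  Bs = allBlocks (length w)
  aInF aInG : Block (length w) → ℚ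
  aInF b = 𝟙 (b ⊆ᵇ m) * (F (a ∷ (w ↾ b)) * G (w ↾ (m ∖ b)))
  aInG b = 𝟙 (b ⊆ᵇ m) * (F (w ↾ b) * G (a ∷ (w ↾ (m ∖ b))))

-- Shuffle powers of Σ_{i ≥ 1} Φ_{{1,…,i}} tⁱ

nonemptyWord : Word → Bool
nonemptyWord []      = false
nonemptyWord (_ ∷ _) = true

constWords : Series
constWords u = 𝟙 (nonemptyWord u ∧ constantOn u (Vec.replicate (length u) true))

phiGen : TSeries
phiGen = genFun PhiSeq

PhiSeq-apply : ∀ n u → PhiSeq n u ≡ 𝟙 (length u ≡ᵇ n) * 𝟙 (constantOn u (Vec.replicate (length u) true))
PhiSeq-apply n u with length u ℕ.≟ n
... | yes refl = trans (if-𝟙 ((length u ≡ᵇ length u) ∧ (c ∧ true)))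
                       (trans (𝟙-∧ (length u ≡ᵇ length u) (c ∧ true))
                              (cong (λ b → 𝟙 (length u ≡ᵇ length u) * 𝟙 b) (BoolP.∧-identityʳ c)))
  where c = constantOn u (Vec.replicate (length u) true)
... | no  u≢n  = trans (cong (λ b → if b ∧ (constantOn u (Vec.replicate n true) ∧ true) then 1ℚ else 0ℚ)
                             (≢⇒≡ᵇ-false u≢n))
                       (sym (δ-≢ (𝟙 (constantOn u (Vec.replicate (length u) true))) u≢n))

phiGen-apply : ∀ i u → phiGen i u ≡ 𝟙 (length u ≡ᵇ i) * constWords u
phiGen-apply zero    []      = sym (*-identityˡ 0ℚ)
phiGen-apply zero    (a ∷ u) = sym (*-zeroˡ (constWords (a ∷ u)))
phiGen-apply (suc i) []      = sym (*-zeroˡ 0ℚ)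
phiGen-apply (suc i) (a ∷ u) = PhiSeq-apply (suc i) (a ∷ u)

allFalse : ∀ {n} → Vec Bool n → Bool
allFalse []      = true
allFalse (x ∷ m) = not x ∧ allFalse m

-- bs is an ordered list of pairwise disjoint blocks whose union is m.
tiles : ∀ {n} → Vec Bool n → List (Block n) → Bool
tiles m []       = allFalse m
tiles m (b ∷ bs) = (b ⊆ᵇ m) ∧ tiles (m ∖ b) bs

∏constWords : (w : Word) → List (Block (length w)) → ℚ
∏constWords w = List.foldr (λ b → constWords (w ↾ b) *_) 1ℚ

orderedTilings : ℕ → (w : Word) → Vec Bool (length w) → ℚ
orderedTilings k w m = ∑[ bs ∈ listsOfLength k (allBlocks (length w)) ] (𝟙 (tiles m bs) * ∏constWords w bs)

oneS-↾ : ∀ w m → oneS (w ↾ m) ≡ 𝟙 (allFalse m)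
oneS-↾ []      []          = refl
oneS-↾ (a ∷ w) (true ∷ m)  = refl
oneS-↾ (a ∷ w) (false ∷ m) = oneS-↾ w m

allFalse≡blockSize≡ᵇ0 : ∀ {n} (m : Vec Bool n) → allFalse m ≡ (blockSize m ≡ᵇ 0)
allFalse≡blockSize≡ᵇ0 []          = refl
allFalse≡blockSize≡ᵇ0 (true ∷ m)  = refl
allFalse≡blockSize≡ᵇ0 (false ∷ m) = allFalse≡blockSize≡ᵇ0 m

length-↾ : ∀ w b → length (w ↾ b) ≡ blockSize b
length-↾ []      []          = refl
length-↾ (a ∷ w) (true ∷ b)  = cong suc (length-↾ w b)
length-↾ (a ∷ w) (false ∷ b) = length-↾ w b

blockSize-∖ : ∀ {n} (b m : Vec Bool n) → (b ⊆ᵇ m) ≡ true → blockSize b ℕ.+ blockSize (m ∖ b) ≡ blockSize m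
blockSize-∖ []          []          _   = refl
blockSize-∖ (true ∷ b)  (true ∷ m)  b⊆m = cong suc (blockSize-∖ b m b⊆m)
blockSize-∖ (false ∷ b) (true ∷ m)  b⊆m = trans (ℕP.+-suc (blockSize b) _) (cong suc (blockSize-∖ b m b⊆m))
blockSize-∖ (false ∷ b) (false ∷ m) b⊆m = blockSize-∖ b m b⊆m

orderedTilings-suc : ∀ k w m → orderedTilings (suc k) w m ≡
  ∑[ b ∈ allBlocks (length w) ] (𝟙 (b ⊆ᵇ m) * (constWords (w ↾ b) * orderedTilings k w (m ∖ b)))
orderedTilings-suc k w m = begin
    ∑ (concatMap (λ b → map (b ∷_) Lk) Bs) summand
      ≡⟨ ∑-concatMap (λ b → map (b ∷_) Lk) Bs summand ⟩
    ∑[ b ∈ Bs ] ∑ (map (b ∷_) Lk) summand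
      ≡⟨ ∑-cong Bs (λ b → trans (∑-map (b ∷_) Lk summand) (∑-cong Lk (regroup b))) ⟩
    ∑[ b ∈ Bs ] ∑[ bs ∈ Lk ] (𝟙 (b ⊆ᵇ m) * constWords (w ↾ b) * summand′ b bs)
      ≡⟨ ∑-cong Bs (λ b → sym (*-distribˡ-∑ (𝟙 (b ⊆ᵇ m) * constWords (w ↾ b)) Lk (summand′ b))) ⟩
    ∑[ b ∈ Bs ] (𝟙 (b ⊆ᵇ m) * constWords (w ↾ b) * orderedTilings k w (m ∖ b))
      ≡⟨ ∑-cong Bs (λ b → *-assoc (𝟙 (b ⊆ᵇ m)) _ _) ⟩
    ∑[ b ∈ Bs ] (𝟙 (b ⊆ᵇ m) * (constWords (w ↾ b) * orderedTilings k w (m ∖ b))) ∎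
  where
  open ≡-Reasoning
  Bs = allBlocks (length w)
  Lk = listsOfLength k Bs
  summand : List (Block (length w)) → ℚ
  summand bs = 𝟙 (tiles m bs) * ∏constWords w bs
  summand′ : Block (length w) → List (Block (length w)) → ℚ
  summand′ b bs = 𝟙 (tiles (m ∖ b) bs) * ∏constWords w bs
  regroup : ∀ b bs → summand (b ∷ bs) ≡ 𝟙 (b ⊆ᵇ m) * constWords (w ↾ b) * summand′ b bs
  regroup b bs = trans (cong (_* ∏constWords w (b ∷ bs)) (𝟙-∧ (b ⊆ᵇ m) (tiles (m ∖ b) bs)))
                       (ℚ*.interchange (𝟙 (b ⊆ᵇ m)) (𝟙 (tiles (m ∖ b) bs)) (constWords (w ↾ b)) (∏constWords w bs))

∑≤-block-sizes : ∀ N w (b m : Vec Bool (length w)) (g s : ℚ) →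
  ∑[ i ≤ N ] (𝟙 (b ⊆ᵇ m) * ((𝟙 (length (w ↾ b) ≡ᵇ i) * g) * (𝟙 (blockSize (m ∖ b) ≡ᵇ N ∸ i) * s)))
  ≡ 𝟙 (b ⊆ᵇ m) * (g * s) * 𝟙 (blockSize m ≡ᵇ N)
∑≤-block-sizes N w b m g s = begin
    ∑[ i ≤ N ] (𝟙 (b ⊆ᵇ m) * ((δ₁ i * g) * (δ₂ i * s)))
      ≡⟨ ∑≤-cong N (λ i → rearrange (𝟙 (b ⊆ᵇ m)) (δ₁ i) g (δ₂ i) s) ⟩
    ∑[ i ≤ N ] (X * (δ₁ i * δ₂ i))               ≡⟨ *-distribˡ-∑≤ X N _ ⟨
    X * ∑[ i ≤ N ] (δ₁ i * δ₂ i)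
      ≡⟨ cong (X *_) (∑≤-δ-convolution N (length (w ↾ b)) (blockSize (m ∖ b))) ⟩
    X * 𝟙 (length (w ↾ b) ℕ.+ blockSize (m ∖ b) ≡ᵇ N)
      ≡⟨ *-assoc (𝟙 (b ⊆ᵇ m)) (g * s) _ ⟩
    𝟙 (b ⊆ᵇ m) * (g * s * 𝟙 (length (w ↾ b) ℕ.+ blockSize (m ∖ b) ≡ᵇ N))
      ≡⟨ 𝟙-guard (b ⊆ᵇ m) (λ b⊆m → cong (λ z → g * s * 𝟙 (z ≡ᵇ N))
           (trans (cong (ℕ._+ blockSize (m ∖ b)) (length-↾ w b)) (blockSize-∖ b m b⊆m))) ⟩
    𝟙 (b ⊆ᵇ m) * (g * s * 𝟙 (blockSize m ≡ᵇ N))  ≡⟨ *-assoc (𝟙 (b ⊆ᵇ m)) (g * s) _ ⟨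
    X * 𝟙 (blockSize m ≡ᵇ N) ∎
  where
  open ≡-Reasoning
  X = 𝟙 (b ⊆ᵇ m) * (g * s)
  rearrange : ∀ a p g q s → a * ((p * g) * (q * s)) ≡ a * (g * s) * (p * q)
  rearrange = solve-∀ ℚ-ring
  δ₁ δ₂ : ℕ → ℚ
  δ₁ i = 𝟙 (length (w ↾ b) ≡ᵇ i)
  δ₂ i = 𝟙 (blockSize (m ∖ b) ≡ᵇ N ∸ i)

tpow-phiGen-↾ : ∀ k N w m → tpow phiGen k N (w ↾ m) ≡ 𝟙 (blockSize m ≡ᵇ N) * orderedTilings k w m
tpow-phiGen-↾ zero zero w m =
  trans (oneS-↾ w m) (trans (cong 𝟙 (allFalse≡blockSize≡ᵇ0 m)) (trans (idem (blockSize m ≡ᵇ 0))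
    (cong (λ c → 𝟙 (blockSize m ≡ᵇ 0) * (𝟙 c * 1ℚ + 0ℚ)) (sym (allFalse≡blockSize≡ᵇ0 m)))))
  where
  idem : ∀ c → 𝟙 c ≡ 𝟙 c * (𝟙 c * 1ℚ + 0ℚ)
  idem true  = refl
  idem false = refl
tpow-phiGen-↾ zero (suc N) w m =
  trans (disjoint (blockSize m))
        (cong (λ c → 𝟙 (blockSize m ≡ᵇ suc N) * (𝟙 c * 1ℚ + 0ℚ)) (sym (allFalse≡blockSize≡ᵇ0 m)))
  where
  disjoint : ∀ s → 0ℚ ≡ 𝟙 (s ≡ᵇ suc N) * (𝟙 (s ≡ᵇ 0) * 1ℚ + 0ℚ)
  disjoint zero    = refl
  disjoint (suc s) = sym (*-zeroʳ (𝟙 (s ≡ᵇ N)))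
tpow-phiGen-↾ (suc k) N w m = begin
    sumUpTo N (λ i → phiGen i ⧢ tpow phiGen k (N ∸ i)) (w ↾ m)   ≡⟨ sumUpTo-apply N _ (w ↾ m) ⟩
    ∑[ i ≤ N ] (phiGen i ⧢ tpow phiGen k (N ∸ i)) (w ↾ m)
      ≡⟨ ∑≤-cong N (λ i → trans (⧢-↾ w _ _ m) (∑-cong Bs (λ b → cong₂ (λ x y → 𝟙 (b ⊆ᵇ m) * (x * y))
           (phiGen-apply i (w ↾ b)) (tpow-phiGen-↾ k (N ∸ i) w (m ∖ b))))) ⟩
    ∑[ i ≤ N ] ∑[ b ∈ Bs ] term i b                     ≡⟨ ∑≤-∑-comm N Bs term ⟩
    ∑[ b ∈ Bs ] ∑[ i ≤ N ] term i b
      ≡⟨ ∑-cong Bs (λ b → ∑≤-block-sizes N w b m (constWords (w ↾ b)) (orderedTilings k w (m ∖ b))) ⟩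
    ∑[ b ∈ Bs ] (firstBlock b * I)                       ≡⟨ ∑-cong Bs (λ b → *-comm (firstBlock b) I) ⟩
    ∑[ b ∈ Bs ] (I * firstBlock b)                       ≡⟨ *-distribˡ-∑ I Bs firstBlock ⟨
    I * ∑[ b ∈ Bs ] firstBlock b                         ≡⟨ cong (I *_) (orderedTilings-suc k w m) ⟨
    I * orderedTilings (suc k) w m ∎
  where
  open ≡-Reasoning
  Bs = allBlocks (length w)
  I = 𝟙 (blockSize m ≡ᵇ N)
  term : ℕ → Block (length w) → ℚ
  term i b = 𝟙 (b ⊆ᵇ m) * ((𝟙 (length (w ↾ b) ≡ᵇ i) * constWords (w ↾ b))
                         * (𝟙 (blockSize (m ∖ b) ≡ᵇ N ∸ i) * orderedTilings k w (m ∖ b)))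
  firstBlock : Block (length w) → ℚ
  firstBlock b = 𝟙 (b ⊆ᵇ m) * (constWords (w ↾ b) * orderedTilings k w (m ∖ b))

-- Ordered versus sorted lists

-- A list of k distinct elements has k! orderings, so symmetric sums over
-- k-tuples without repetitions reduce to sums over sorted tuples.
module Symmetrisation
  {A : Set} (_≟_ : DecidableEquality A) (_<ᵇ_ : A → A → Bool)
  (<ᵇ-irrefl : ∀ x → (x <ᵇ x) ≡ false)
  (<ᵇ-trans : ∀ x y z → (x <ᵇ y) ≡ true → (y <ᵇ z) ≡ true → (x <ᵇ z) ≡ true)
  (<ᵇ-connex : ∀ x y → x ≢ y → (x <ᵇ y) ≡ true ⊎ (y <ᵇ x) ≡ true)
  (X : List A) (∑X-δ : ∀ y (g : A → ℚ) → ∑[ x ∈ X ] (𝟙 (does (x ≟ y)) * g x) ≡ g y)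
  where

  _==_ : A → A → Bool
  x == y = does (x ≟ y)

  ==-refl : ∀ x → (x == x) ≡ true
  ==-refl x = dec-true (x ≟ x) refl

  ≢⇒==-false : ∀ {x y} → x ≢ y → (x == y) ≡ false
  ≢⇒==-false {x} {y} = dec-false (x ≟ y)

  _∈ᵇ_ : A → List A → Bool
  z ∈ᵇ []       = false
  z ∈ᵇ (x ∷ xs) = (z == x) ∨ (z ∈ᵇ xs)

  remove : A → List A → List A
  remove x []       = []
  remove x (y ∷ ys) = if x == y then ys else y ∷ remove x ys

  _↭ᵇ_ : List A → List A → Bool
  []       ↭ᵇ []      = true
  []       ↭ᵇ (_ ∷ _) = false
  (x ∷ xs) ↭ᵇ ys      = (x ∈ᵇ ys) ∧ (xs ↭ᵇ remove x ys)

  distinct : List A → Bool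
  distinct []       = true
  distinct (x ∷ xs) = not (x ∈ᵇ xs) ∧ distinct xs

  sorted : List A → Bool
  sorted []           = true
  sorted (x ∷ [])     = true
  sorted (x ∷ y ∷ xs) = (x <ᵇ y) ∧ sorted (y ∷ xs)

  insert : A → List A → List A
  insert x []       = x ∷ []
  insert x (y ∷ ys) = if x <ᵇ y then x ∷ y ∷ ys else y ∷ insert x ys

  insertionSort : List A → List A
  insertionSort []       = []
  insertionSort (x ∷ xs) = insert x (insertionSort xs)

  module _ {C : Set} (step : A → C → C) (base : C)
    (step-comm : ∀ x y c → step x (step y c) ≡ step y (step x c))
    where

    foldr-remove : ∀ x ys → (x ∈ᵇ ys) ≡ true →
                   List.foldr step base ys ≡ step x (List.foldr step base (remove x ys))
    foldr-remove x (y ∷ ys) x∈ys with x ≟ y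
    ... | yes refl = refl
    ... | no  _    = trans (cong (step y) (foldr-remove x ys x∈ys)) (step-comm y x _)

    foldr-↭ᵇ : ∀ xs ys → (xs ↭ᵇ ys) ≡ true → List.foldr step base xs ≡ List.foldr step base ys
    foldr-↭ᵇ []       []       _     = refl
    foldr-↭ᵇ (x ∷ xs) ys       xs↭ys =
      trans (cong (step x) (foldr-↭ᵇ xs (remove x ys) (∧-conicalʳ _ _ xs↭ys)))
            (sym (foldr-remove x ys (∧-conicalˡ _ _ xs↭ys)))

  count : A → List A → ℕ
  count z = List.foldr (λ x → 𝟙ℕ (z == x) ℕ.+_) 0

  count-↭ᵇ : ∀ xs ys → (xs ↭ᵇ ys) ≡ true → ∀ z → count z xs ≡ count z ys
  count-↭ᵇ xs ys xs↭ys z =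
    foldr-↭ᵇ _ 0 (λ x y → ℕ+.x∙yz≈y∙xz (𝟙ℕ (z == x)) (𝟙ℕ (z == y))) xs ys xs↭ys

  ∈ᵇ-count : ∀ z xs → (z ∈ᵇ xs) ≡ not (count z xs ≡ᵇ 0)
  ∈ᵇ-count z []       = refl
  ∈ᵇ-count z (x ∷ xs) with z == x
  ... | true  = refl
  ... | false = ∈ᵇ-count z xs

  ∈ᵇ-cong-count : ∀ z xs ys → count z xs ≡ count z ys → (z ∈ᵇ xs) ≡ (z ∈ᵇ ys)
  ∈ᵇ-cong-count z xs ys e = trans (∈ᵇ-count z xs) (trans (cong (λ c → not (c ≡ᵇ 0)) e) (sym (∈ᵇ-count z ys)))

  count-remove : ∀ x ys → (x ∈ᵇ ys) ≡ true → ∀ z → count z ys ≡ 𝟙ℕ (z == x) ℕ.+ count z (remove x ys)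
  count-remove x (y ∷ ys) x∈ys z with x ≟ y
  ... | yes refl = refl
  ... | no  _    = trans (cong (𝟙ℕ (z == y) ℕ.+_) (count-remove x ys x∈ys z))
                         (ℕ+.x∙yz≈y∙xz (𝟙ℕ (z == y)) (𝟙ℕ (z == x)) (count z (remove x ys)))

  count⇒↭ᵇ : ∀ xs ys → (∀ z → count z xs ≡ count z ys) → (xs ↭ᵇ ys) ≡ true
  count⇒↭ᵇ []       []       _ = refl
  count⇒↭ᵇ []       (y ∷ ys) e = ⊥-elim (ℕP.0≢1+n (trans (e y) (cong (λ b → 𝟙ℕ b ℕ.+ count y ys) (==-refl y))))
  count⇒↭ᵇ (x ∷ xs) ys       e = cong₂ _∧_ x∈ys
      (count⇒↭ᵇ xs (remove x ys) (λ z →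
        ℕP.+-cancelˡ-≡ (𝟙ℕ (z == x)) _ _ (trans (e z) (count-remove x ys x∈ys z))))
    where
    x∈ys : (x ∈ᵇ ys) ≡ true
    x∈ys = trans (∈ᵇ-cong-count x ys (x ∷ xs) (sym (e x))) (cong (_∨ (x ∈ᵇ xs)) (==-refl x))

  count-insert : ∀ z x ys → count z (insert x ys) ≡ count z (x ∷ ys)
  count-insert z x []       = refl
  count-insert z x (y ∷ ys) with x <ᵇ y
  ... | true  = refl
  ... | false = trans (cong (𝟙ℕ (z == y) ℕ.+_) (count-insert z x ys))
                      (ℕ+.x∙yz≈y∙xz (𝟙ℕ (z == y)) (𝟙ℕ (z == x)) (count z ys))

  count-insertionSort : ∀ z xs → count z (insertionSort xs) ≡ count z xs
  count-insertionSort z []       = refl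
  count-insertionSort z (x ∷ xs) =
    trans (count-insert z x (insertionSort xs)) (cong (𝟙ℕ (z == x) ℕ.+_) (count-insertionSort z xs))

  ↭ᵇ-insertionSort : ∀ xs → (xs ↭ᵇ insertionSort xs) ≡ true
  ↭ᵇ-insertionSort xs = count⇒↭ᵇ xs (insertionSort xs) (λ z → sym (count-insertionSort z xs))

  ∉ᵇ-head : ∀ x y ys → (x ∈ᵇ (y ∷ ys)) ≡ false → x ≢ y
  ∉ᵇ-head x _ ys x∉ refl = true≢false (trans (sym (cong (_∨ (x ∈ᵇ ys)) (==-refl x))) x∉)

  ∉ᵇ-tail : ∀ x y ys → (x ∈ᵇ (y ∷ ys)) ≡ false → (x ∈ᵇ ys) ≡ false
  ∉ᵇ-tail x y ys = BoolP.∨-conicalʳ (x == y) (x ∈ᵇ ys)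

  distinct⇒∉ᵇ : ∀ x xs → distinct (x ∷ xs) ≡ true → (x ∈ᵇ xs) ≡ false
  distinct⇒∉ᵇ x xs d = trans (sym (BoolP.not-involutive (x ∈ᵇ xs))) (cong not (∧-conicalˡ _ _ d))

  sorted-∷-insert : ∀ y ys x → (y <ᵇ x) ≡ true → sorted (y ∷ ys) ≡ true → (x ∈ᵇ ys) ≡ false →
                    sorted (y ∷ insert x ys) ≡ true
  sorted-∷-insert y []       x y<x _ _ = cong (_∧ true) y<x
  sorted-∷-insert y (z ∷ zs) x y<x s x∉ with x <ᵇ z in x<z
  ... | true  = cong₂ _∧_ y<x (cong₂ _∧_ x<z (∧-conicalʳ _ _ s))
  ... | false with <ᵇ-connex x z (∉ᵇ-head x z zs x∉)
  ...   | inj₁ x<z′ = ⊥-elim (true≢false (trans (sym x<z′) x<z))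
  ...   | inj₂ z<x  =
    cong₂ _∧_ (∧-conicalˡ _ _ s) (sorted-∷-insert z zs x z<x (∧-conicalʳ _ _ s) (∉ᵇ-tail x z zs x∉))

  sorted-insert : ∀ x ys → sorted ys ≡ true → (x ∈ᵇ ys) ≡ false → sorted (insert x ys) ≡ true
  sorted-insert x []       _ _ = refl
  sorted-insert x (y ∷ ys) s x∉ with x <ᵇ y in x<y
  ... | true  = cong₂ _∧_ x<y s
  ... | false with <ᵇ-connex x y (∉ᵇ-head x y ys x∉)
  ...   | inj₁ x<y′ = ⊥-elim (true≢false (trans (sym x<y′) x<y))
  ...   | inj₂ y<x  = sorted-∷-insert y ys x y<x s (∉ᵇ-tail x y ys x∉)

  sorted-insertionSort : ∀ xs → distinct xs ≡ true → sorted (insertionSort xs) ≡ true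
  sorted-insertionSort []       _ = refl
  sorted-insertionSort (x ∷ xs) d = sorted-insert x (insertionSort xs) (sorted-insertionSort xs (∧-conicalʳ _ _ d))
    (trans (∈ᵇ-cong-count x (insertionSort xs) xs (count-insertionSort x xs)) (distinct⇒∉ᵇ x xs d))

  sorted-tail : ∀ a s → sorted (a ∷ s) ≡ true → sorted s ≡ true
  sorted-tail a []      _ = refl
  sorted-tail a (b ∷ s) e = ∧-conicalʳ _ _ e

  sorted-head< : ∀ a s z → sorted (a ∷ s) ≡ true → (z ∈ᵇ s) ≡ true → (a <ᵇ z) ≡ true
  sorted-head< a (b ∷ s) z e z∈ with z ≟ b
  ... | yes refl = ∧-conicalˡ _ _ e
  ... | no  _    = <ᵇ-trans a b z (∧-conicalˡ _ _ e) (sorted-head< b s z (∧-conicalʳ _ _ e) z∈)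

  sorted-head∉ᵇ : ∀ a s → sorted (a ∷ s) ≡ true → (a ∈ᵇ s) ≡ false
  sorted-head∉ᵇ a s e = ¬-not (λ a∈s → true≢false (trans (sym (sorted-head< a s a e a∈s)) (<ᵇ-irrefl a)))

  sorted-unique : ∀ s t → sorted s ≡ true → sorted t ≡ true → (∀ z → (z ∈ᵇ s) ≡ (z ∈ᵇ t)) → s ≡ t
  sorted-unique []      []      _  _  _   = refl
  sorted-unique []      (b ∷ t) _  _  s≈t =
    ⊥-elim (true≢false (trans (sym (cong (_∨ (b ∈ᵇ t)) (==-refl b))) (sym (s≈t b))))
  sorted-unique (a ∷ s) []      _  _  s≈t =
    ⊥-elim (true≢false (trans (sym (cong (_∨ (a ∈ᵇ s)) (==-refl a))) (s≈t a)))
  sorted-unique (a ∷ s) (b ∷ t) ss st s≈t with a ≟ b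
  ... | yes refl = cong (a ∷_) (sorted-unique s t (sorted-tail a s ss) (sorted-tail a t st) tails)
    where
    tails : ∀ z → (z ∈ᵇ s) ≡ (z ∈ᵇ t)
    tails z with z ≟ a
    ... | yes refl = trans (sorted-head∉ᵇ a s ss) (sym (sorted-head∉ᵇ a t st))
    ... | no  z≢a  = trans (cong (_∨ (z ∈ᵇ s)) (sym (≢⇒==-false z≢a)))
                           (trans (s≈t z) (cong (_∨ (z ∈ᵇ t)) (≢⇒==-false z≢a)))
  ... | no  a≢b  = ⊥-elim (true≢false (trans (sym (<ᵇ-trans a b a a<b b<a)) (<ᵇ-irrefl a)))
    where
    a<b = sorted-head< a s b ss (trans (cong (_∨ (b ∈ᵇ s)) (sym (≢⇒==-false (a≢b ∘ sym))))
                                       (trans (s≈t b) (cong (_∨ (b ∈ᵇ t)) (==-refl b))))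
    b<a = sorted-head< b t a st (trans (cong (_∨ (a ∈ᵇ t)) (sym (≢⇒==-false a≢b)))
                                       (trans (sym (s≈t a)) (cong (_∨ (a ∈ᵇ s)) (==-refl a))))

  ∈ᵇ-↭ᵇ : ∀ xs ys → (xs ↭ᵇ ys) ≡ true → ∀ z → (z ∈ᵇ xs) ≡ (z ∈ᵇ ys)
  ∈ᵇ-↭ᵇ xs ys xs↭ys z = ∈ᵇ-cong-count z xs ys (count-↭ᵇ xs ys xs↭ys z)

  ∈ᵇ-remove⇒∈ᵇ : ∀ z x s → (z ∈ᵇ remove x s) ≡ true → (z ∈ᵇ s) ≡ true
  ∈ᵇ-remove⇒∈ᵇ z x (y ∷ s) z∈ with x == y
  ... | true  = trans (cong ((z == y) ∨_) z∈) (BoolP.∨-zeroʳ (z == y))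
  ... | false with z == y
  ...   | true  = refl
  ...   | false = ∈ᵇ-remove⇒∈ᵇ z x s z∈

  distinct-remove : ∀ x s → distinct s ≡ true → distinct (remove x s) ≡ true
  distinct-remove x []      _ = refl
  distinct-remove x (y ∷ s) d with x == y
  ... | true  = ∧-conicalʳ _ _ d
  ... | false = cong₂ _∧_
    (cong not (¬-not (λ y∈ → true≢false (trans (sym (∈ᵇ-remove⇒∈ᵇ y x s y∈)) (distinct⇒∉ᵇ y s d)))))
    (distinct-remove x s (∧-conicalʳ _ _ d))

  length-remove : ∀ x s → (x ∈ᵇ s) ≡ true → suc (length (remove x s)) ≡ length s
  length-remove x (y ∷ s) x∈ with x == y
  ... | true  = refl
  ... | false = cong suc (length-remove x s x∈)

  length-insertionSort : ∀ xs → length (insertionSort xs) ≡ length xs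
  length-insertionSort []       = refl
  length-insertionSort (x ∷ xs) = trans (length-insert (insertionSort xs)) (cong suc (length-insertionSort xs))
    where
    length-insert : ∀ ys → length (insert x ys) ≡ suc (length ys)
    length-insert []       = refl
    length-insert (y ∷ ys) with x <ᵇ y
    ... | true  = refl
    ... | false = cong suc (length-insert ys)

  _≟ˡ_ : DecidableEquality (List A)
  _≟ˡ_ = ListP.≡-dec _≟_

  sorted∧↭ᵇ≡≟insertionSort : ∀ xs → distinct xs ≡ true →
    ∀ s → (sorted s ∧ (xs ↭ᵇ s)) ≡ does (s ≟ˡ insertionSort xs)
  sorted∧↭ᵇ≡≟insertionSort xs d s = ⇔→≡ (mk⇔
    (λ e → dec-true (s ≟ˡ insertionSort xs)
      (sorted-unique s (insertionSort xs) (∧-conicalˡ _ _ e) (sorted-insertionSort xs d)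
        (λ z → trans (sym (∈ᵇ-↭ᵇ xs s (∧-conicalʳ _ _ e) z))
                     (∈ᵇ-cong-count z xs (insertionSort xs) (sym (count-insertionSort z xs))))))
    (λ e → subst (λ t → (sorted t ∧ (xs ↭ᵇ t)) ≡ true) (sym (does-true⇒ (s ≟ˡ insertionSort xs) e))
      (cong₂ _∧_ (sorted-insertionSort xs d) (↭ᵇ-insertionSort xs))))

  tuples : ℕ → List (List A)
  tuples k = listsOfLength k X

  ∑-tuples-suc : ∀ k (h : List A → ℚ) → ∑ (tuples (suc k)) h ≡ ∑[ x ∈ X ] ∑[ s ∈ tuples k ] h (x ∷ s)
  ∑-tuples-suc k h = trans (∑-concatMap (λ x → map (x ∷_) (tuples k)) X h)
                           (∑-cong X (λ x → ∑-map (x ∷_) (tuples k) h))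

  ∑-tuples-cong : ∀ k {f g : List A → ℚ} → (∀ xs → length xs ≡ k → f xs ≡ g xs) →
                  ∑ (tuples k) f ≡ ∑ (tuples k) g
  ∑-tuples-cong zero    f≗g = cong (_+ 0ℚ) (f≗g [] refl)
  ∑-tuples-cong (suc k) {f} {g} f≗g = begin
    ∑ (tuples (suc k)) f                   ≡⟨ ∑-tuples-suc k f ⟩
    ∑[ x ∈ X ] ∑[ s ∈ tuples k ] f (x ∷ s)
      ≡⟨ ∑-cong X (λ x → ∑-tuples-cong k (λ s ∣s∣≡k → f≗g (x ∷ s) (cong suc ∣s∣≡k))) ⟩
    ∑[ x ∈ X ] ∑[ s ∈ tuples k ] g (x ∷ s)  ≡⟨ ∑-tuples-suc k g ⟨
    ∑ (tuples (suc k)) g                   ∎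
    where open ≡-Reasoning

  ∑-tuples-δ : ∀ k t → length t ≡ k → ∀ (g : List A → ℚ) →
               ∑[ s ∈ tuples k ] (𝟙 (does (s ≟ˡ t)) * g s) ≡ g t
  ∑-tuples-δ zero    []      refl g = trans (+-identityʳ _) (*-identityˡ (g []))
  ∑-tuples-δ (suc k) (y ∷ t) refl g = begin
      ∑[ s ∈ tuples (suc k) ] (𝟙 (does (s ≟ˡ (y ∷ t))) * g s)
        ≡⟨ ∑-tuples-suc k _ ⟩
      ∑[ x ∈ X ] ∑[ s ∈ tuples k ] (𝟙 ((x == y) ∧ does (s ≟ˡ t)) * g (x ∷ s))
        ≡⟨ ∑-cong X (λ x → trans (∑-cong (tuples k) (λ s → trans (cong (_* g (x ∷ s)) (𝟙-∧ (x == y) _))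
                                                                 (*-assoc (𝟙 (x == y)) _ _)))
                                 (sym (*-distribˡ-∑ (𝟙 (x == y)) (tuples k) _))) ⟩
      ∑[ x ∈ X ] (𝟙 (x == y) * ∑[ s ∈ tuples k ] (𝟙 (does (s ≟ˡ t)) * g (x ∷ s)))
        ≡⟨ ∑-cong X (λ x → cong (𝟙 (x == y) *_) (∑-tuples-δ k t refl (λ s → g (x ∷ s)))) ⟩
      ∑[ x ∈ X ] (𝟙 (x == y) * g (x ∷ t))
        ≡⟨ ∑X-δ y (λ x → g (x ∷ t)) ⟩
      g (y ∷ t) ∎
    where open ≡-Reasoning

  ∑X-∈ᵇ : ∀ s → distinct s ≡ true → ∑[ x ∈ X ] 𝟙 (x ∈ᵇ s) ≡ fromℕ (length s)
  ∑X-∈ᵇ []      _ = ∑-zero X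
  ∑X-∈ᵇ (y ∷ s) d = begin
      ∑[ x ∈ X ] 𝟙 ((x == y) ∨ (x ∈ᵇ s))           ≡⟨ ∑-cong X split ⟩
      ∑[ x ∈ X ] (𝟙 (x == y) + 𝟙 (x ∈ᵇ s))         ≡⟨ ∑-+ X _ _ ⟩
      ∑[ x ∈ X ] 𝟙 (x == y) + ∑[ x ∈ X ] 𝟙 (x ∈ᵇ s)
        ≡⟨ cong₂ _+_ (trans (∑-cong X (λ x → sym (*-identityʳ (𝟙 (x == y))))) (∑X-δ y (λ _ → 1ℚ)))
                     (∑X-∈ᵇ s (∧-conicalʳ _ _ d)) ⟩
      1ℚ + fromℕ (length s)                         ≡⟨ fromℕ-+ 1 (length s) ⟨
      fromℕ (length (y ∷ s))                        ∎
    where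
    open ≡-Reasoning
    split : ∀ x → 𝟙 ((x == y) ∨ (x ∈ᵇ s)) ≡ 𝟙 (x == y) + 𝟙 (x ∈ᵇ s)
    split x with x ≟ y
    ... | yes refl = cong (λ b → 1ℚ + 𝟙 b) (sym (distinct⇒∉ᵇ x s d))
    ... | no  _    = sym (+-identityˡ (𝟙 (x ∈ᵇ s)))

  ∑-tuples-↭ᵇ : ∀ k s → length s ≡ k → distinct s ≡ true →
                ∑[ xs ∈ tuples k ] 𝟙 (xs ↭ᵇ s) ≡ fromℕ (k !)
  ∑-tuples-↭ᵇ zero    []  refl _ = refl
  ∑-tuples-↭ᵇ (suc k) s ∣s∣≡1+k d = begin
      ∑[ xs ∈ tuples (suc k) ] 𝟙 (xs ↭ᵇ s)                            ≡⟨ ∑-tuples-suc k _ ⟩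
      ∑[ x ∈ X ] ∑[ ys ∈ tuples k ] 𝟙 ((x ∈ᵇ s) ∧ (ys ↭ᵇ remove x s))  ≡⟨ ∑-cong X removeHead ⟩
      ∑[ x ∈ X ] (𝟙 (x ∈ᵇ s) * fromℕ (k !))                           ≡⟨ ∑-cong X (λ x → *-comm (𝟙 (x ∈ᵇ s)) _) ⟩
      ∑[ x ∈ X ] (fromℕ (k !) * 𝟙 (x ∈ᵇ s))                           ≡⟨ *-distribˡ-∑ (fromℕ (k !)) X _ ⟨
      fromℕ (k !) * ∑[ x ∈ X ] 𝟙 (x ∈ᵇ s)       ≡⟨ cong (fromℕ (k !) *_) (trans (∑X-∈ᵇ s d) (cong fromℕ ∣s∣≡1+k)) ⟩
      fromℕ (k !) * fromℕ (suc k)               ≡⟨ *-comm (fromℕ (k !)) (fromℕ (suc k)) ⟩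
      fromℕ (suc k) * fromℕ (k !)               ≡⟨ fromℕ-* (suc k) (k !) ⟨
      fromℕ (suc k !)                           ∎
    where
    open ≡-Reasoning
    removeHead : ∀ x → ∑[ ys ∈ tuples k ] 𝟙 ((x ∈ᵇ s) ∧ (ys ↭ᵇ remove x s)) ≡ 𝟙 (x ∈ᵇ s) * fromℕ (k !)
    removeHead x with x ∈ᵇ s in x∈s
    ... | false = trans (∑-zero (tuples k)) (sym (*-zeroˡ (fromℕ (k !))))
    ... | true  = trans (∑-tuples-↭ᵇ k (remove x s) (ℕP.suc-injective (trans (length-remove x s x∈s) ∣s∣≡1+k))
                                     (distinct-remove x s d))
                        (sym (*-identityˡ (fromℕ (k !))))

  ∑-tuples-symmetric : (q : List A → ℚ) →
    (∀ xs ys → (xs ↭ᵇ ys) ≡ true → q xs ≡ q ys) → (∀ xs → distinct xs ≡ false → q xs ≡ 0ℚ) →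
    ∀ k → ∑ (tuples k) q ≡ fromℕ (k !) * ∑[ s ∈ tuples k ] (𝟙 (sorted s) * q s)
  ∑-tuples-symmetric q q-↭ᵇ q-repeated k = begin
      ∑ (tuples k) q                                                         ≡⟨ ∑-tuples-cong k bySorting ⟩
      ∑[ xs ∈ tuples k ] ∑[ s ∈ tuples k ] (𝟙 (sorted s ∧ (xs ↭ᵇ s)) * q xs)  ≡⟨ ∑-comm (tuples k) (tuples k) _ ⟩
      ∑[ s ∈ tuples k ] ∑[ xs ∈ tuples k ] (𝟙 (sorted s ∧ (xs ↭ᵇ s)) * q xs)  ≡⟨ ∑-tuples-cong k orderings ⟩
      ∑[ s ∈ tuples k ] (fromℕ (k !) * (𝟙 (sorted s) * q s))        ≡⟨ *-distribˡ-∑ (fromℕ (k !)) (tuples k) _ ⟨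
      fromℕ (k !) * ∑[ s ∈ tuples k ] (𝟙 (sorted s) * q s)          ∎
    where
    open ≡-Reasoning
    q-vanishes : ∀ c xs → distinct xs ≡ false → c * q xs ≡ 0ℚ
    q-vanishes c xs rep = trans (cong (c *_) (q-repeated xs rep)) (*-zeroʳ c)

    bySorting : ∀ xs → length xs ≡ k → q xs ≡ ∑[ s ∈ tuples k ] (𝟙 (sorted s ∧ (xs ↭ᵇ s)) * q xs)
    bySorting xs ∣xs∣≡k with distinct xs in d
    ... | true  = sym (trans (∑-cong (tuples k) (λ s → cong (λ b → 𝟙 b * q xs) (sorted∧↭ᵇ≡≟insertionSort xs d s)))
                             (∑-tuples-δ k (insertionSort xs) (trans (length-insertionSort xs) ∣xs∣≡k) (λ _ → q xs)))
    ... | false = trans (q-repeated xs d)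
                        (sym (trans (∑-cong (tuples k) (λ s → q-vanishes (𝟙 (sorted s ∧ (xs ↭ᵇ s))) xs d))
                                    (∑-zero (tuples k))))

    orderings : ∀ s → length s ≡ k →
      ∑[ xs ∈ tuples k ] (𝟙 (sorted s ∧ (xs ↭ᵇ s)) * q xs) ≡ fromℕ (k !) * (𝟙 (sorted s) * q s)
    orderings s ∣s∣≡k = begin
        ∑[ xs ∈ tuples k ] (𝟙 (sorted s ∧ (xs ↭ᵇ s)) * q xs)
          ≡⟨ ∑-tuples-cong k (λ xs _ → trans (cong (_* q xs) (𝟙-∧ (sorted s) (xs ↭ᵇ s))) (onOrbit xs)) ⟩
        ∑[ xs ∈ tuples k ] (𝟙 (sorted s) * q s * 𝟙 (xs ↭ᵇ s))
          ≡⟨ *-distribˡ-∑ (𝟙 (sorted s) * q s) (tuples k) _ ⟨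
        𝟙 (sorted s) * q s * ∑[ xs ∈ tuples k ] 𝟙 (xs ↭ᵇ s)    ≡⟨ countOrbit ⟩
        𝟙 (sorted s) * q s * fromℕ (k !)                       ≡⟨ *-comm _ (fromℕ (k !)) ⟩
        fromℕ (k !) * (𝟙 (sorted s) * q s)                     ∎
      where
      onOrbit : ∀ xs → 𝟙 (sorted s) * 𝟙 (xs ↭ᵇ s) * q xs ≡ 𝟙 (sorted s) * q s * 𝟙 (xs ↭ᵇ s)
      onOrbit xs with xs ↭ᵇ s in xs↭s
      ... | true  = trans (cong (𝟙 (sorted s) * 1ℚ *_) (q-↭ᵇ xs s xs↭s))
                          (ℚ*.xy∙z≈xz∙y (𝟙 (sorted s)) 1ℚ (q s))
      ... | false = trans (cong (_* q xs) (*-zeroʳ (𝟙 (sorted s))))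
                          (trans (*-zeroˡ (q xs)) (sym (*-zeroʳ (𝟙 (sorted s) * q s))))
      countOrbit : 𝟙 (sorted s) * q s * ∑[ xs ∈ tuples k ] 𝟙 (xs ↭ᵇ s) ≡ 𝟙 (sorted s) * q s * fromℕ (k !)
      countOrbit with distinct s in d
      ... | true  = cong (𝟙 (sorted s) * q s *_) (∑-tuples-↭ᵇ k s ∣s∣≡k d)
      ... | false = trans (vanish _) (sym (vanish _))
        where
        vanish : ∀ r → 𝟙 (sorted s) * q s * r ≡ 0ℚ
        vanish r = trans (cong (_* r) (q-vanishes (𝟙 (sorted s)) s d)) (*-zeroˡ r)

_≟ᴮ_ : ∀ {n} → DecidableEquality (Block n)
_≟ᴮ_ = VecP.≡-dec Bool._≟_

lexLt-irrefl : ∀ {n} (x : Block n) → lexLt x x ≡ false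
lexLt-irrefl []          = refl
lexLt-irrefl (true ∷ x)  = lexLt-irrefl x
lexLt-irrefl (false ∷ x) = lexLt-irrefl x

lexLt-trans : ∀ {n} (x y z : Block n) → lexLt x y ≡ true → lexLt y z ≡ true → lexLt x z ≡ true
lexLt-trans []          []          []          ()
lexLt-trans (false ∷ x) (false ∷ y) (false ∷ z) p q  = lexLt-trans x y z p q
lexLt-trans (false ∷ x) (false ∷ y) (true ∷ z)  p q  = refl
lexLt-trans (false ∷ x) (true ∷ y)  (true ∷ z)  p q  = refl
lexLt-trans (true ∷ x)  (true ∷ y)  (true ∷ z)  p q  = lexLt-trans x y z p q
lexLt-trans (false ∷ x) (true ∷ y)  (false ∷ z) p ()
lexLt-trans (true ∷ x)  (false ∷ y) z           () q
lexLt-trans (true ∷ x)  (true ∷ y)  (false ∷ z) p ()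

lexLt-connex : ∀ {n} (x y : Block n) → x ≢ y → lexLt x y ≡ true ⊎ lexLt y x ≡ true
lexLt-connex []          []          x≢y = ⊥-elim (x≢y refl)
lexLt-connex (false ∷ x) (true ∷ y)  x≢y = inj₁ refl
lexLt-connex (true ∷ x)  (false ∷ y) x≢y = inj₂ refl
lexLt-connex (false ∷ x) (false ∷ y) x≢y = lexLt-connex x y (x≢y ∘ cong (false ∷_))
lexLt-connex (true ∷ x)  (true ∷ y)  x≢y = lexLt-connex x y (x≢y ∘ cong (true ∷_))

∑-allBlocks-δ : ∀ n (y : Block n) (g : Block n → ℚ) → ∑[ x ∈ allBlocks n ] (𝟙 (does (x ≟ᴮ y)) * g x) ≡ g y
∑-allBlocks-δ zero    []       g = trans (+-identityʳ _) (*-identityˡ (g []))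
∑-allBlocks-δ (suc n) (y₀ ∷ y) g = trans (∑-allBlocks-suc n _)
  (trans (∑-cong (allBlocks n) (firstBit y₀)) (∑-allBlocks-δ n y (λ b → g (y₀ ∷ b))))
  where
  firstBit : ∀ y₀ b → 𝟙 (does ((false ∷ b) ≟ᴮ (y₀ ∷ y))) * g (false ∷ b)
                      + 𝟙 (does ((true ∷ b) ≟ᴮ (y₀ ∷ y))) * g (true ∷ b)
                      ≡ 𝟙 (does (b ≟ᴮ y)) * g (y₀ ∷ b)
  firstBit false b = trans (cong (𝟙 (does (b ≟ᴮ y)) * g (false ∷ b) +_) (*-zeroˡ (g (true ∷ b)))) (+-identityʳ _)
  firstBit true  b = trans (cong (_+ 𝟙 (does (b ≟ᴮ y)) * g (true ∷ b)) (*-zeroˡ (g (false ∷ b)))) (+-identityˡ _)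

module BlockLists (n : ℕ) =
  Symmetrisation (_≟ᴮ_ {n}) lexLt lexLt-irrefl lexLt-trans lexLt-connex (allBlocks n) (∑-allBlocks-δ n)

allB-tabulate⇒ : ∀ n (g : Fin n → A) (p : A → Bool) → allB p (tabulate g) ≡ true → ∀ i → p (g i) ≡ true
allB-tabulate⇒ (suc n) g p all Fin.zero    = ∧-conicalˡ _ _ all
allB-tabulate⇒ (suc n) g p all (Fin.suc i) = allB-tabulate⇒ n (g ∘ Fin.suc) p (∧-conicalʳ _ _ all) i

allB-tabulate⇐ : ∀ n (g : Fin n → A) (p : A → Bool) → (∀ i → p (g i) ≡ true) → allB p (tabulate g) ≡ true
allB-tabulate⇐ zero    g p _   = refl
allB-tabulate⇐ (suc n) g p all = cong₂ _∧_ (all Fin.zero) (allB-tabulate⇐ n (g ∘ Fin.suc) p (all ∘ Fin.suc))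

ConstantOn : Word → ∀ {n} → Block n → Set
ConstantOn w {n} b = ∀ (i j : Fin n) → Vec.lookup b i ≡ true → Vec.lookup b j ≡ true → nth w (toℕ i) ≡ nth w (toℕ j)

module _ (w : Word) {n : ℕ} (b : Block n) where

  private
    entry : Fin n → Fin n → Bool
    entry i j = not (member b i ∧ member b j) ∨ (nth w (toℕ i) ≡ᵇ nth w (toℕ j))

    entry⇒ : ∀ x y u v → (not (x ∧ y) ∨ (u ≡ᵇ v)) ≡ true → x ≡ true → y ≡ true → u ≡ v
    entry⇒ true true u v e refl refl = ≡ᵇ-true⇒≡ u v e

    entry⇐ : ∀ x y u v → (x ≡ true → y ≡ true → u ≡ v) → (not (x ∧ y) ∨ (u ≡ᵇ v)) ≡ true
    entry⇐ true  true  u v h = ≡⇒≡ᵇ-true (h refl refl)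
    entry⇐ true  false u v h = refl
    entry⇐ false y     u v h = refl

  constantOn⇒ : constantOn w b ≡ true → ConstantOn w b
  constantOn⇒ c i j = entry⇒ _ _ _ _
    (allB-tabulate⇒ n (λ j → j) (entry i) (allB-tabulate⇒ n (λ i → i) _ c i) j)

  constantOn⇐ : ConstantOn w b → constantOn w b ≡ true
  constantOn⇐ c = allB-tabulate⇐ n (λ i → i) _ (λ i →
    allB-tabulate⇐ n (λ j → j) (entry i) (λ j → entry⇐ _ _ _ _ (c i j)))

↾-position⁻ : ∀ w (b : Vec Bool (length w)) (i : Fin (length (w ↾ b))) →
  Σ (Fin (length w)) (λ j → (Vec.lookup b j ≡ true) × (nth w (toℕ j) ≡ nth (w ↾ b) (toℕ i)))
↾-position⁻ []      []          ()
↾-position⁻ (a ∷ w) (true ∷ b)  Fin.zero    = Fin.zero , refl , refl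
↾-position⁻ (a ∷ w) (true ∷ b)  (Fin.suc i) with ↾-position⁻ w b i
... | j , bⱼ , wⱼ = Fin.suc j , bⱼ , wⱼ
↾-position⁻ (a ∷ w) (false ∷ b) i           with ↾-position⁻ w b i
... | j , bⱼ , wⱼ = Fin.suc j , bⱼ , wⱼ

↾-position⁺ : ∀ w (b : Vec Bool (length w)) (j : Fin (length w)) → Vec.lookup b j ≡ true →
  Σ (Fin (length (w ↾ b))) (λ i → nth (w ↾ b) (toℕ i) ≡ nth w (toℕ j))
↾-position⁺ (a ∷ w) (true ∷ b)  Fin.zero    _  = Fin.zero , refl
↾-position⁺ (a ∷ w) (true ∷ b)  (Fin.suc j) bⱼ with ↾-position⁺ w b j bⱼ
... | i , wᵢ = Fin.suc i , wᵢ
↾-position⁺ (a ∷ w) (false ∷ b) (Fin.suc j) bⱼ = ↾-position⁺ w b j bⱼ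

constantOn-↾ : ∀ w b → constantOn (w ↾ b) (Vec.replicate (length (w ↾ b)) true) ≡ constantOn w b
constantOn-↾ w b = ⇔→≡ (mk⇔
    (λ c → constantOn⇐ w b (ConstantOn-↾⇒ (constantOn⇒ (w ↾ b) full c)))
    (λ c → constantOn⇐ (w ↾ b) full (ConstantOn-↾⇐ (constantOn⇒ w b c))))
  where
  full = Vec.replicate (length (w ↾ b)) true
  ConstantOn-↾⇒ : ConstantOn (w ↾ b) full → ConstantOn w b
  ConstantOn-↾⇒ c j₁ j₂ b₁ b₂ with ↾-position⁺ w b j₁ b₁ | ↾-position⁺ w b j₂ b₂
  ... | i₁ , w₁ | i₂ , w₂ =
    trans (sym w₁) (trans (c i₁ i₂ (VecP.lookup-replicate i₁ true) (VecP.lookup-replicate i₂ true)) w₂)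
  ConstantOn-↾⇐ : ConstantOn w b → ConstantOn (w ↾ b) full
  ConstantOn-↾⇐ c i₁ i₂ _ _ with ↾-position⁻ w b i₁ | ↾-position⁻ w b i₂
  ... | j₁ , b₁ , w₁ | j₂ , b₂ , w₂ = trans (sym w₁) (trans (c j₁ j₂ b₁ b₂) w₂)

nonemptyWord-↾ : ∀ w b → nonemptyWord (w ↾ b) ≡ nonempty b
nonemptyWord-↾ []      []          = refl
nonemptyWord-↾ (a ∷ w) (true ∷ b)  = refl
nonemptyWord-↾ (a ∷ w) (false ∷ b) = nonemptyWord-↾ w b

constWords-↾ : ∀ w b → constWords (w ↾ b) ≡ 𝟙 (nonempty b ∧ constantOn w b)
constWords-↾ w b = cong₂ (λ x y → 𝟙 (x ∧ y)) (nonemptyWord-↾ w b) (constantOn-↾ w b)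

multiplicity : ∀ {n} → List (Block n) → Fin n → ℕ
multiplicity bs i = countB (λ b → member b i) bs

multiplicity-∷ : ∀ {n} b bs (i : Fin n) → multiplicity (b ∷ bs) i ≡ 𝟙ℕ (member b i) ℕ.+ multiplicity bs i
multiplicity-∷ b bs i with member b i
... | true  = refl
... | false = refl

allFalse⇒ : ∀ {n} (m : Vec Bool n) → allFalse m ≡ true → ∀ i → 0 ≡ 𝟙ℕ (Vec.lookup m i)
allFalse⇒ (false ∷ m) e Fin.zero    = refl
allFalse⇒ (false ∷ m) e (Fin.suc i) = allFalse⇒ m e i

allFalse⇐ : ∀ {n} (m : Vec Bool n) → (∀ i → 0 ≡ 𝟙ℕ (Vec.lookup m i)) → allFalse m ≡ true
allFalse⇐ []          _ = refl
allFalse⇐ (false ∷ m) h = allFalse⇐ m (h ∘ Fin.suc)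
allFalse⇐ (true ∷ m)  h with () ← h Fin.zero

⊆ᵇ⇒ : ∀ {n} (b m : Vec Bool n) → (b ⊆ᵇ m) ≡ true → ∀ i → Vec.lookup b i ≡ true → Vec.lookup m i ≡ true
⊆ᵇ⇒ (true ∷ b)  (true ∷ m)  _   Fin.zero    _  = refl
⊆ᵇ⇒ (true ∷ b)  (true ∷ m)  b⊆m (Fin.suc i) bᵢ = ⊆ᵇ⇒ b m b⊆m i bᵢ
⊆ᵇ⇒ (false ∷ b) (y ∷ m)     b⊆m (Fin.suc i) bᵢ = ⊆ᵇ⇒ b m b⊆m i bᵢ

⊆ᵇ⇐ : ∀ {n} (b m : Vec Bool n) → (∀ i → Vec.lookup b i ≡ true → Vec.lookup m i ≡ true) → (b ⊆ᵇ m) ≡ true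
⊆ᵇ⇐ []          []      _ = refl
⊆ᵇ⇐ (true ∷ b)  (y ∷ m) h = cong₂ _∧_ (h Fin.zero refl) (⊆ᵇ⇐ b m (h ∘ Fin.suc))
⊆ᵇ⇐ (false ∷ b) (y ∷ m) h = ⊆ᵇ⇐ b m (h ∘ Fin.suc)

lookup-∖ : ∀ {n} (m b : Vec Bool n) i → Vec.lookup (m ∖ b) i ≡ (Vec.lookup m i ∧ not (Vec.lookup b i))
lookup-∖ (y ∷ m) (x ∷ b) Fin.zero    = refl
lookup-∖ (y ∷ m) (x ∷ b) (Fin.suc i) = lookup-∖ m b i

-- x and y are the entries of b and m at one position, c the multiplicity there of the remaining blocks.
private
  position-split⇒ : ∀ x y c → (x ≡ true → y ≡ true) → c ≡ 𝟙ℕ (y ∧ not x) → 𝟙ℕ x ℕ.+ c ≡ 𝟙ℕ y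
  position-split⇒ true  true  c _ refl = refl
  position-split⇒ true  false c h _    with () ← h refl
  position-split⇒ false true  c _ refl = refl
  position-split⇒ false false c _ refl = refl

  position-split⇐⊆ : ∀ x y c → 𝟙ℕ x ℕ.+ c ≡ 𝟙ℕ y → x ≡ true → y ≡ true
  position-split⇐⊆ true true  c _ _ = refl

  position-split⇐∖ : ∀ x y c → 𝟙ℕ x ℕ.+ c ≡ 𝟙ℕ y → c ≡ 𝟙ℕ (y ∧ not x)
  position-split⇐∖ true  true  c e = ℕP.suc-injective e
  position-split⇐∖ false true  c e = e
  position-split⇐∖ false false c e = e

tiles⇒ : ∀ {n} (m : Vec Bool n) bs → tiles m bs ≡ true → ∀ i → multiplicity bs i ≡ 𝟙ℕ (Vec.lookup m i)
tiles⇒ m []       t i = allFalse⇒ m t i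
tiles⇒ m (b ∷ bs) t i = trans (multiplicity-∷ b bs i)
  (position-split⇒ (Vec.lookup b i) (Vec.lookup m i) (multiplicity bs i) (⊆ᵇ⇒ b m (∧-conicalˡ _ _ t) i)
     (trans (tiles⇒ (m ∖ b) bs (∧-conicalʳ _ _ t) i) (cong 𝟙ℕ (lookup-∖ m b i))))

tiles⇐ : ∀ {n} (m : Vec Bool n) bs → (∀ i → multiplicity bs i ≡ 𝟙ℕ (Vec.lookup m i)) → tiles m bs ≡ true
tiles⇐ m []       h = allFalse⇐ m h
tiles⇐ m (b ∷ bs) h = cong₂ _∧_
    (⊆ᵇ⇐ b m (λ i → position-split⇐⊆ _ _ _ (h′ i)))
    (tiles⇐ (m ∖ b) bs (λ i → trans (position-split⇐∖ _ _ _ (h′ i)) (cong 𝟙ℕ (sym (lookup-∖ m b i)))))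
  where
  h′ : ∀ i → 𝟙ℕ (Vec.lookup b i) ℕ.+ multiplicity bs i ≡ 𝟙ℕ (Vec.lookup m i)
  h′ i = trans (sym (multiplicity-∷ b bs i)) (h i)

tiles-full : ∀ n (bs : List (Block n)) →
  tiles (Vec.replicate n true) bs ≡ allB (λ i → multiplicity bs i ≡ᵇ 1) (allFin n)
tiles-full n bs = ⇔→≡ (mk⇔
  (λ t → allB-tabulate⇐ n (λ i → i) _ (λ i →
     ≡⇒≡ᵇ-true (trans (tiles⇒ _ bs t i) (cong 𝟙ℕ (VecP.lookup-replicate i true)))))
  (λ e → tiles⇐ _ bs (λ i →
     trans (≡ᵇ-true⇒≡ _ _ (allB-tabulate⇒ n (λ i → i) _ e i)) (sym (cong 𝟙ℕ (VecP.lookup-replicate i true))))))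

⊆ᵇ-∖⇒⊆ᵇ : ∀ {n} (c m b : Vec Bool n) → (c ⊆ᵇ (m ∖ b)) ≡ true → (c ⊆ᵇ m) ≡ true
⊆ᵇ-∖⇒⊆ᵇ c m b c⊆ =
  ⊆ᵇ⇐ c m (λ i cᵢ → ∧-conicalˡ _ _ (trans (sym (lookup-∖ m b i)) (⊆ᵇ⇒ c (m ∖ b) c⊆ i cᵢ)))

nonempty⇒⊈ᵇ-∖self : ∀ {n} (b m : Vec Bool n) → nonempty b ≡ true → (b ⊆ᵇ (m ∖ b)) ≢ true
nonempty⇒⊈ᵇ-∖self (true ∷ b)  (true ∷ m)  _ ()
nonempty⇒⊈ᵇ-∖self (true ∷ b)  (false ∷ m) _ ()
nonempty⇒⊈ᵇ-∖self (false ∷ b) (y ∷ m)     ne = nonempty⇒⊈ᵇ-∖self b m ne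

module _ {n : ℕ} where
  open BlockLists n using (_∈ᵇ_; distinct; _↭ᵇ_; foldr-↭ᵇ)

  tiles-∈ᵇ⇒⊆ᵇ : ∀ (m : Vec Bool n) bs c → tiles m bs ≡ true → (c ∈ᵇ bs) ≡ true → (c ⊆ᵇ m) ≡ true
  tiles-∈ᵇ⇒⊆ᵇ m (b ∷ bs) c t c∈ with c ≟ᴮ b
  ... | yes refl = ∧-conicalˡ _ _ t
  ... | no  _    = ⊆ᵇ-∖⇒⊆ᵇ c m b (tiles-∈ᵇ⇒⊆ᵇ (m ∖ b) bs c (∧-conicalʳ _ _ t) c∈)

  tiles⇒distinct : ∀ (m : Vec Bool n) bs → tiles m bs ≡ true → allB nonempty bs ≡ true → distinct bs ≡ true
  tiles⇒distinct m []       _ _  = refl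
  tiles⇒distinct m (b ∷ bs) t ne = cong₂ _∧_
    (cong not (¬-not (λ b∈ → nonempty⇒⊈ᵇ-∖self b m (∧-conicalˡ _ _ ne)
                               (tiles-∈ᵇ⇒⊆ᵇ (m ∖ b) bs b (∧-conicalʳ _ _ t) b∈))))
    (tiles⇒distinct (m ∖ b) bs (∧-conicalʳ _ _ t) (∧-conicalʳ _ _ ne))

  multiplicity-↭ᵇ : ∀ xs ys → (xs ↭ᵇ ys) ≡ true → ∀ i → multiplicity xs i ≡ multiplicity ys i
  multiplicity-↭ᵇ xs ys xs↭ys i = trans (asFoldr xs)
      (trans (foldr-↭ᵇ _ 0 (λ x y → ℕ+.x∙yz≈y∙xz (𝟙ℕ (member x i)) (𝟙ℕ (member y i))) xs ys xs↭ys)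
             (sym (asFoldr ys)))
    where
    asFoldr : ∀ bs → multiplicity bs i ≡ List.foldr (λ b → 𝟙ℕ (member b i) ℕ.+_) 0 bs
    asFoldr []       = refl
    asFoldr (b ∷ bs) = trans (multiplicity-∷ b bs i) (cong (𝟙ℕ (member b i) ℕ.+_) (asFoldr bs))

  tiles-↭ᵇ : ∀ (m : Vec Bool n) xs ys → (xs ↭ᵇ ys) ≡ true → tiles m xs ≡ tiles m ys
  tiles-↭ᵇ m xs ys xs↭ys = ⇔→≡ (mk⇔
    (λ t → tiles⇐ m ys (λ i → trans (sym (multiplicity-↭ᵇ xs ys xs↭ys i)) (tiles⇒ m xs t i)))
    (λ t → tiles⇐ m xs (λ i → trans (multiplicity-↭ᵇ xs ys xs↭ys i) (tiles⇒ m ys t i))))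

∏constWords-↭ᵇ : ∀ w xs ys → BlockLists._↭ᵇ_ (length w) xs ys ≡ true → ∏constWords w xs ≡ ∏constWords w ys
∏constWords-↭ᵇ w = BlockLists.foldr-↭ᵇ (length w) _ 1ℚ (λ x y → ℚ*.x∙yz≈y∙xz (constWords (w ↾ x)) (constWords (w ↾ y)))

∏constWords≡𝟙 : ∀ w bs → ∏constWords w bs ≡ 𝟙 (allB (λ b → nonempty b ∧ constantOn w b) bs)
∏constWords≡𝟙 w []       = refl
∏constWords≡𝟙 w (b ∷ bs) =
  trans (cong₂ _*_ (constWords-↾ w b) (∏constWords≡𝟙 w bs)) (sym (𝟙-∧ (nonempty b ∧ constantOn w b) _))

-- Sorted tilings by constant blocks are set partitions

↾-full : ∀ w → w ↾ Vec.replicate (length w) true ≡ w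
↾-full []      = refl
↾-full (a ∷ w) = cong (a ∷_) (↾-full w)

blockSize-full : ∀ n → blockSize (Vec.replicate n true) ≡ n
blockSize-full zero    = refl
blockSize-full (suc n) = cong suc (blockSize-full n)

sorted≡sortedStrict : ∀ {n} (s : List (Block n)) → BlockLists.sorted n s ≡ sortedStrict s
sorted≡sortedStrict []          = refl
sorted≡sortedStrict (b ∷ [])    = refl
sorted≡sortedStrict (b ∷ c ∷ s) = cong (lexLt b c ∧_) (sorted≡sortedStrict (c ∷ s))

allB-∧ : (p r : A → Bool) (xs : List A) → allB (λ x → p x ∧ r x) xs ≡ (allB p xs ∧ allB r xs)
allB-∧ p r []       = refl
allB-∧ p r (x ∷ xs) = begin
  (p x ∧ r x) ∧ allB (λ x → p x ∧ r x) xs  ≡⟨ cong ((p x ∧ r x) ∧_) (allB-∧ p r xs) ⟩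
  (p x ∧ r x) ∧ (allB p xs ∧ allB r xs)    ≡⟨ ∧-interchange (p x) (r x) (allB p xs) (allB r xs) ⟩
  (p x ∧ allB p xs) ∧ (r x ∧ allB r xs)    ∎
  where
  open ≡-Reasoning
  ∧-interchange = CommSemigroupProps.interchange (CommutativeMonoid.commutativeSemigroup BoolP.∧-commutativeMonoid)

∑-filter : (p : A → Bool) (g : A → ℚ) (xs : List A) →
  List.foldr (λ x r → g x + r) 0ℚ (filter (λ x → p x Bool.≟ true) xs) ≡ ∑[ x ∈ xs ] (𝟙 (p x) * g x)
∑-filter p g []       = refl
∑-filter p g (x ∷ xs) with p x
... | true  = cong₂ _+_ (sym (*-identityˡ (g x))) (∑-filter p g xs)
... | false = trans (∑-filter p g xs) (sym (trans (cong (_+ _) (*-zeroˡ (g x))) (+-identityˡ _)))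

setPartitionSum : ℕ → ℕ → Word → ℚ
setPartitionSum n k w = ∑[ π ∈ listsOfLength k (allBlocks n) ] (𝟙 (isSetPartition n π) * 𝟙 (allB (constantOn w) π))

Bfrak-apply : ∀ n k w → Bfrak n k w ≡ 𝟙 (length w ≡ᵇ n) * setPartitionSum n k w
Bfrak-apply n k w = begin
    List.foldr (λ π r → Phi n π w + r) 0ℚ (setPartitions n k)
      ≡⟨ ∑-filter (isSetPartition n) (λ π → Phi n π w) (listsOfLength k (allBlocks n)) ⟩
    ∑[ π ∈ Πs ] (𝟙 (isSetPartition n π) * Phi n π w)
      ≡⟨ ∑-cong Πs (λ π → cong (𝟙 (isSetPartition n π) *_) (trans (if-𝟙 _) (𝟙-∧ (length w ≡ᵇ n) _))) ⟩
    ∑[ π ∈ Πs ] (𝟙 (isSetPartition n π) * (δ * 𝟙 (allB (constantOn w) π)))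
      ≡⟨ ∑-cong Πs (λ π → ℚ*.x∙yz≈y∙xz (𝟙 (isSetPartition n π)) δ _) ⟩
    ∑[ π ∈ Πs ] (δ * (𝟙 (isSetPartition n π) * 𝟙 (allB (constantOn w) π)))
      ≡⟨ *-distribˡ-∑ δ Πs _ ⟨
    δ * setPartitionSum n k w ∎
  where
  open ≡-Reasoning
  Πs = listsOfLength k (allBlocks n)
  δ = 𝟙 (length w ≡ᵇ n)

module _ (w : Word) where
  private
    n = length w
    full = Vec.replicate n true
    open BlockLists n using (sorted; distinct; _↭ᵇ_; tuples; ∑-tuples-symmetric)

    tiling : List (Block n) → ℚ
    tiling bs = 𝟙 (tiles full bs) * ∏constWords w bs

    tiling-↭ᵇ : ∀ xs ys → (xs ↭ᵇ ys) ≡ true → tiling xs ≡ tiling ys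
    tiling-↭ᵇ xs ys xs↭ys = cong₂ (λ a b → 𝟙 a * b) (tiles-↭ᵇ full xs ys xs↭ys) (∏constWords-↭ᵇ w xs ys xs↭ys)

    tiling-repeated : ∀ xs → distinct xs ≡ false → tiling xs ≡ 0ℚ
    tiling-repeated xs rep with tiles full xs in t | allB (λ b → nonempty b ∧ constantOn w b) xs in c
    ... | false | _     = *-zeroˡ (∏constWords w xs)
    ... | true  | false = trans (*-identityˡ (∏constWords w xs)) (trans (∏constWords≡𝟙 w xs) (cong 𝟙 c))
    ... | true  | true  = ⊥-elim (true≢false (trans (sym (tiles⇒distinct full xs t nonempties)) rep))
      where
      nonempties : allB nonempty xs ≡ true
      nonempties = ∧-conicalˡ _ _ (trans (sym (allB-∧ nonempty (constantOn w) xs)) c)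

    rearrange : ∀ S C NE CS → S * (C * (NE * CS)) ≡ (NE * (C * S)) * CS
    rearrange = solve-∀ ℚ-ring

    sortedTiling≡setPartition : ∀ s → 𝟙 (sorted s) * tiling s ≡ 𝟙 (isSetPartition n s) * 𝟙 (allB (constantOn w) s)
    sortedTiling≡setPartition s = begin
        𝟙 (sorted s) * (𝟙 (tiles full s) * ∏constWords w s)
          ≡⟨ cong₂ (λ a b → 𝟙 a * (𝟙 (tiles full s) * b)) (sorted≡sortedStrict s)
               (trans (∏constWords≡𝟙 w s) (cong 𝟙 (allB-∧ nonempty (constantOn w) s))) ⟩
        𝟙 S * (𝟙 (tiles full s) * 𝟙 (NE ∧ CS))
          ≡⟨ cong₂ (λ a b → 𝟙 S * (𝟙 a * b)) (tiles-full n s) (𝟙-∧ NE CS) ⟩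
        𝟙 S * (𝟙 C * (𝟙 NE * 𝟙 CS))       ≡⟨ rearrange (𝟙 S) (𝟙 C) (𝟙 NE) (𝟙 CS) ⟩
        (𝟙 NE * (𝟙 C * 𝟙 S)) * 𝟙 CS
          ≡⟨ cong (_* 𝟙 CS) (trans (cong (𝟙 NE *_) (sym (𝟙-∧ C S))) (sym (𝟙-∧ NE (C ∧ S)))) ⟩
        𝟙 (NE ∧ (C ∧ S)) * 𝟙 CS           ∎
      where
      open ≡-Reasoning
      S  = sortedStrict s
      C  = allB (λ i → multiplicity s i ≡ᵇ 1) (allFin n)
      NE = allB nonempty s
      CS = allB (constantOn w) s

  orderedTilings≡k!*setPartitionSum : ∀ k → orderedTilings k w full ≡ fromℕ (k !) * setPartitionSum n k w
  orderedTilings≡k!*setPartitionSum k =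
    trans (∑-tuples-symmetric tiling tiling-↭ᵇ tiling-repeated k)
          (cong (fromℕ (k !) *_) (∑-cong (tuples k) sortedTiling≡setPartition))

  Bword-Phi-apply : ∀ N k → Bword N k PhiSeq w ≡ 𝟙 (n ≡ᵇ N) * setPartitionSum n k w
  Bword-Phi-apply N k = begin
      inv! k * tpow phiGen k N w                             ≡⟨ cong (λ u → inv! k * tpow phiGen k N u) (↾-full w) ⟨
      inv! k * tpow phiGen k N (w ↾ full)                    ≡⟨ cong (inv! k *_) (tpow-phiGen-↾ k N w full) ⟩
      inv! k * (𝟙 (blockSize full ≡ᵇ N) * orderedTilings k w full)
        ≡⟨ cong₂ (λ a b → inv! k * (𝟙 (a ≡ᵇ N) * b)) (blockSize-full n) (orderedTilings≡k!*setPartitionSum k) ⟩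
      inv! k * (𝟙 (n ≡ᵇ N) * (fact k * setPartitionSum n k w))
        ≡⟨ regroup (inv! k) (𝟙 (n ≡ᵇ N)) (fact k) (setPartitionSum n k w) ⟩
      𝟙 (n ≡ᵇ N) * ((inv! k * fact k) * setPartitionSum n k w)
        ≡⟨ cong (λ c → 𝟙 (n ≡ᵇ N) * (c * setPartitionSum n k w)) (inv!*fact k) ⟩
      𝟙 (n ≡ᵇ N) * (1ℚ * setPartitionSum n k w)             ≡⟨ cong (𝟙 (n ≡ᵇ N) *_) (*-identityˡ _) ⟩
      𝟙 (n ≡ᵇ N) * setPartitionSum n k w                     ∎
    where
    open ≡-Reasoning
    regroup : ∀ a d f s → a * (d * (f * s)) ≡ d * ((a * f) * s)
    regroup = solve-∀ ℚ-ring

Bword≐Bfrak : ∀ n k → Bword n k PhiSeq ≐ Bfrak n k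
Bword≐Bfrak n k w = begin
    Bword n k PhiSeq w                                 ≡⟨ Bword-Phi-apply w n k ⟩
    𝟙 (length w ≡ᵇ n) * setPartitionSum (length w) k w
      ≡⟨ 𝟙-guard (length w ≡ᵇ n) (λ e → cong (λ m → setPartitionSum m k w) (≡ᵇ-true⇒≡ _ _ e)) ⟩
    𝟙 (length w ≡ᵇ n) * setPartitionSum n k w          ≡⟨ Bfrak-apply n k w ⟨
    Bfrak n k w                                        ∎
  where open ≡-Reasoning

mainTheorem10 : (n k : ℕ) →
    (Bword n k PsiSeq ≐ Bcal n k PsiSeq) × (Bword n k PhiSeq ≐ Bfrak n k)
mainTheorem10 n k = Bword≐Bcal n k PsiSeq , Bword≐Bfrak n k
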